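{- Let $M\in{\cal T}'$ be correct. If $T_1(M)\triangleright N$, then there is a correct term $M'$ such that $M\triangleright^+ M'$ and $T_1(M')=N$.
   Context: Intuitionistic variables $x,y,\dots$, classical variables $a,b,\dots$. Terms ${\cal T} ::= x \mid \lambda x\, {\cal T} \mid ({\cal T}\ {\cal E}) \mid \langle {\cal T},{\cal T}\rangle \mid \omega_1 {\cal T} \mid \omega_2 {\cal T} \mid \mu a\, {\cal T} \mid (a\ {\cal T})$, ${\cal E} ::= {\cal T} \mid \pi_1 \mid \pi_2 \mid [x.{\cal T}, y.{\cal T}]$. Reduction on ${\cal T}$: compatible closure of $(\lambda x M\ N)\triangleright M[x:=N]$; $(\langle M_1,M_2\rangle\ \pi_i)\triangleright M_i$; $(\omega_i M\ [x_1.N_1,x_2.N_2])\triangleright N_i[x_i:=M]$; $(M\ [x_1.N_1,x_2.N_2]\ \varepsilon)\triangleright (M\ [x_1.(N_1\ \varepsilon),x_2.(N_2\ \varepsilon)])$; $(\mu a M\ \varepsilon)\triangleright \mu a\, M[a:=^*\varepsilon]$, where $M[a:=^*\varepsilon]$ replaces each subterm $(a\ P)$ by $(a\ (P\ \varepsilon))$. Marked terms ${\cal T}'$: the grammar of ${\cal T}$ extended with $N^\star$ (for $N\in{\cal T}$) and $\boxed{\varepsilon}$ (in argument position, for $\varepsilon\in{\cal T}\cup\{\pi_1,\pi_2\}$), with $N,\varepsilon$ unmarked and closed (free variables treated as constants). Reduction on ${\cal T}'$: rules of ${\cal T}$, plus $N\triangleright N'$ implies $N^\star\triangleright N'^\star$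 and $\boxed{N}\triangleright\boxed{N'}$, and $(N^\star\ \boxed{\varepsilon})\triangleright(N\ \varepsilon)$; $\triangleright^+$ is the transitive closure. $M\in{\cal T}'$ is acceptable iff $M=N^\star$, or $M=\mu aM_1$ and for each subterm $(a\ N)$ of $M$, $N$ is acceptable, or $M=(N\ [x_1.N_1,x_2.N_2])$ with $N_1,N_2$ acceptable. For acceptable $M$: $st(N^\star)=\{N^\star\}$, $st(\mu aM_1)=\bigcup\{st(S)\mid(a\ S)$ subterm of $M_1\}$, $st((N\ [x_1.N_1,x_2.N_2]))=st(N_1)\cup st(N_2)$. $M\in{\cal T}'$ is correct if (1) each occurrence of a subterm $\boxed{\varepsilon}$ appears as $(U\ \boxed{\varepsilon})$ for some acceptable $U$, and (2) for each occurrence of a subterm $N^\star$ of $M$ there is a (necessarily unique) subterm of the form $(U\ \boxed{\varepsilon})$ such that $N^\star\in st(U)$. For $M\in{\cal T}'$, $T_1(M)\in{\cal T}$ is the term obtained by replacing every $N^\star$ by $N$ and every $\boxed{\varepsilon}$ by $\varepsilon$. -}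

module Defs where

open import Data.Nat using (ℕ; zero; suc; _+_; _∸_; _<ᵇ_; _≡ᵇ_)
open import Data.Bool using (if_then_else_)
open import Data.List using (List; []; _∷_; _++_; map; [_])
open import Data.List.Relation.Unary.All using (All)
open import Data.List.Membership.Propositional using (_∈_)
open import Data.Maybe using (Maybe; just; nothing)
open import Data.Product using (Σ; _×_)
open import Relation.Binary.PropositionalEquality using (_≡_)

-- Conventions.
-- de Bruijn indices, with two separate index spaces: intuitionistic
-- variables (bound by lam and by the two branches of a case) and
-- classical variables (bound by μ).

-- Unmarked terms  T  and eliminators  E

data Tm : Set
data El : Set

data Tm where
  var  : ℕ → Tm
  lam  : Tm → Tm
  app  : Tm → El → Tm
  pair : Tm → Tm → Tm
  ω₁   : Tm → Tm
  ω₂   : Tm → Tm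
  μ    : Tm → Tm             -- μa T
  nam  : ℕ → Tm → Tm         -- (a T)

data El where
  arg  : Tm → El
  π₁   : El
  π₂   : El
  case : Tm → Tm → El        -- [x.T , y.T]

shiftVar : ℕ → ℕ → ℕ → ℕ
shiftVar k n j = if j <ᵇ k then j else j + n

ishift  : ℕ → ℕ → Tm → Tm
ishiftE : ℕ → ℕ → El → El
ishift k n (var j)    = var (shiftVar k n j)
ishift k n (lam M)    = lam (ishift (suc k) n M)
ishift k n (app M e)  = app (ishift k n M) (ishiftE k n e)
ishift k n (pair M N) = pair (ishift k n M) (ishift k n N)
ishift k n (ω₁ M)     = ω₁ (ishift k n M)
ishift k n (ω₂ M)     = ω₂ (ishift k n M)
ishift k n (μ M)      = μ (ishift k n M)
ishift k n (nam a M)  = nam a (ishift k n M)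
ishiftE k n (arg M)    = arg (ishift k n M)
ishiftE k n π₁         = π₁
ishiftE k n π₂         = π₂
ishiftE k n (case M N) = case (ishift (suc k) n M) (ishift (suc k) n N)

cshift  : ℕ → ℕ → Tm → Tm
cshiftE : ℕ → ℕ → El → El
cshift k n (var j)    = var j
cshift k n (lam M)    = lam (cshift k n M)
cshift k n (app M e)  = app (cshift k n M) (cshiftE k n e)
cshift k n (pair M N) = pair (cshift k n M) (cshift k n N)
cshift k n (ω₁ M)     = ω₁ (cshift k n M)
cshift k n (ω₂ M)     = ω₂ (cshift k n M)
cshift k n (μ M)      = μ (cshift (suc k) n M)
cshift k n (nam a M)  = nam (shiftVar k n a) (cshift k n M)
cshiftE k n (arg M)    = arg (cshift k n M)
cshiftE k n π₁         = π₁
cshiftE k n π₂         = π₂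
cshiftE k n (case M N) = case (cshift k n M) (cshift k n N)

-- isub k P M : M[x_k := P]  (the binder of x_k is removed: larger indices drop by one)
substVar : ℕ → Tm → ℕ → Tm
substVar k P j = if j ≡ᵇ k then P else (if j <ᵇ k then var j else var (j ∸ 1))

isub  : ℕ → Tm → Tm → Tm
isubE : ℕ → Tm → El → El
isub k P (var j)    = substVar k P j
isub k P (lam M)    = lam (isub (suc k) (ishift 0 1 P) M)
isub k P (app M e)  = app (isub k P M) (isubE k P e)
isub k P (pair M N) = pair (isub k P M) (isub k P N)
isub k P (ω₁ M)     = ω₁ (isub k P M)
isub k P (ω₂ M)     = ω₂ (isub k P M)
isub k P (μ M)      = μ (isub k (cshift 0 1 P) M)
isub k P (nam a M)  = nam a (isub k P M)
isubE k P (arg M)    = arg (isub k P M)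
isubE k P π₁         = π₁
isubE k P π₂         = π₂
isubE k P (case M N) = case (isub (suc k) (ishift 0 1 P) M) (isub (suc k) (ishift 0 1 P) N)

-- csub k ε M : M[a_k :=* ε]  (each (a_k P) becomes (a_k (P ε)))
csub  : ℕ → El → Tm → Tm
csubE : ℕ → El → El → El
csub k ε (var j)    = var j
csub k ε (lam M)    = lam (csub k (ishiftE 0 1 ε) M)
csub k ε (app M e)  = app (csub k ε M) (csubE k ε e)
csub k ε (pair M N) = pair (csub k ε M) (csub k ε N)
csub k ε (ω₁ M)     = ω₁ (csub k ε M)
csub k ε (ω₂ M)     = ω₂ (csub k ε M)
csub k ε (μ M)      = μ (csub (suc k) (cshiftE 0 1 ε) M)
csub k ε (nam a M)  = if a ≡ᵇ k then nam a (app (csub k ε M) ε) else nam a (csub k ε M)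
csubE k ε (arg M)    = arg (csub k ε M)
csubE k ε π₁         = π₁
csubE k ε π₂         = π₂
csubE k ε (case M N) = case (csub k (ishiftE 0 1 ε) M) (csub k (ishiftE 0 1 ε) N)

infix 4 _⟶_ _⟶E_
data _⟶_ : Tm → Tm → Set
data _⟶E_ : El → El → Set

data _⟶_ where
  β    : ∀ {M N} → app (lam M) (arg N) ⟶ isub 0 N M
  proj₁ : ∀ {M₁ M₂} → app (pair M₁ M₂) π₁ ⟶ M₁
  proj₂ : ∀ {M₁ M₂} → app (pair M₁ M₂) π₂ ⟶ M₂
  inj₁ : ∀ {M N₁ N₂} → app (ω₁ M) (case N₁ N₂) ⟶ isub 0 M N₁
  inj₂ : ∀ {M N₁ N₂} → app (ω₂ M) (case N₁ N₂) ⟶ isub 0 M N₂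
  comm : ∀ {M N₁ N₂ ε} →
         app (app M (case N₁ N₂)) ε ⟶
         app M (case (app N₁ (ishiftE 0 1 ε)) (app N₂ (ishiftE 0 1 ε)))
  μr   : ∀ {M ε} → app (μ M) ε ⟶ μ (csub 0 (cshiftE 0 1 ε) M)
  c-lam   : ∀ {M M'} → M ⟶ M' → lam M ⟶ lam M'
  c-appL  : ∀ {M M' e} → M ⟶ M' → app M e ⟶ app M' e
  c-appR  : ∀ {M e e'} → e ⟶E e' → app M e ⟶ app M e'
  c-pairL : ∀ {M M' N} → M ⟶ M' → pair M N ⟶ pair M' N
  c-pairR : ∀ {M N N'} → N ⟶ N' → pair M N ⟶ pair M N'
  c-ω₁    : ∀ {M M'} → M ⟶ M' → ω₁ M ⟶ ω₁ M'
  c-ω₂    : ∀ {M M'} → M ⟶ M' → ω₂ M ⟶ ω₂ M'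
  c-μ     : ∀ {M M'} → M ⟶ M' → μ M ⟶ μ M'
  c-nam   : ∀ {a M M'} → M ⟶ M' → nam a M ⟶ nam a M'

data _⟶E_ where
  c-arg   : ∀ {M M'} → M ⟶ M' → arg M ⟶E arg M'
  c-caseL : ∀ {M M' N} → M ⟶ M' → case M N ⟶E case M' N
  c-caseR : ∀ {M N N'} → N ⟶ N' → case M N ⟶E case M N'

-- Marked terms  T'

-- contents of a box: ε ∈ T ∪ {π₁, π₂}
data Box : Set where
  bt  : Tm → Box
  bπ₁ : Box
  bπ₂ : Box

data Tm' : Set
data El' : Set

data Tm' where
  var  : ℕ → Tm'
  lam  : Tm' → Tm'
  app  : Tm' → El' → Tm'
  pair : Tm' → Tm' → Tm'
  ω₁   : Tm' → Tm'
  ω₂   : Tm' → Tm'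
  μ    : Tm' → Tm'
  nam  : ℕ → Tm' → Tm'
  star : Tm → Tm'            -- N⋆

data El' where
  arg  : Tm' → El'
  π₁   : El'
  π₂   : El'
  case : Tm' → Tm' → El'
  box  : Box → El'           -- [ε] (boxed), only in argument position

-- The contents of N⋆ and [ε] are "closed, free variables treated as
-- constants": their free indices refer to the global (top-level) context
-- and are never captured; shifting / substitution do not enter them.

ishift'  : ℕ → ℕ → Tm' → Tm'
ishiftE' : ℕ → ℕ → El' → El'
ishift' k n (var j)    = var (shiftVar k n j)
ishift' k n (lam M)    = lam (ishift' (suc k) n M)
ishift' k n (app M e)  = app (ishift' k n M) (ishiftE' k n e)
ishift' k n (pair M N) = pair (ishift' k n M) (ishift' k n N)
ishift' k n (ω₁ M)     = ω₁ (ishift' k n M)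
ishift' k n (ω₂ M)     = ω₂ (ishift' k n M)
ishift' k n (μ M)      = μ (ishift' k n M)
ishift' k n (nam a M)  = nam a (ishift' k n M)
ishift' k n (star N)   = star N
ishiftE' k n (arg M)    = arg (ishift' k n M)
ishiftE' k n π₁         = π₁
ishiftE' k n π₂         = π₂
ishiftE' k n (case M N) = case (ishift' (suc k) n M) (ishift' (suc k) n N)
ishiftE' k n (box b)    = box b

cshift'  : ℕ → ℕ → Tm' → Tm'
cshiftE' : ℕ → ℕ → El' → El'
cshift' k n (var j)    = var j
cshift' k n (lam M)    = lam (cshift' k n M)
cshift' k n (app M e)  = app (cshift' k n M) (cshiftE' k n e)
cshift' k n (pair M N) = pair (cshift' k n M) (cshift' k n N)
cshift' k n (ω₁ M)     = ω₁ (cshift' k n M)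
cshift' k n (ω₂ M)     = ω₂ (cshift' k n M)
cshift' k n (μ M)      = μ (cshift' (suc k) n M)
cshift' k n (nam a M)  = nam (shiftVar k n a) (cshift' k n M)
cshift' k n (star N)   = star N
cshiftE' k n (arg M)    = arg (cshift' k n M)
cshiftE' k n π₁         = π₁
cshiftE' k n π₂         = π₂
cshiftE' k n (case M N) = case (cshift' k n M) (cshift' k n N)
cshiftE' k n (box b)    = box b

substVar' : ℕ → Tm' → ℕ → Tm'
substVar' k P j = if j ≡ᵇ k then P else (if j <ᵇ k then var j else var (j ∸ 1))

isub'  : ℕ → Tm' → Tm' → Tm'
isubE' : ℕ → Tm' → El' → El'
isub' k P (var j)    = substVar' k P j
isub' k P (lam M)    = lam (isub' (suc k) (ishift' 0 1 P) M)
isub' k P (app M e)  = app (isub' k P M) (isubE' k P e)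
isub' k P (pair M N) = pair (isub' k P M) (isub' k P N)
isub' k P (ω₁ M)     = ω₁ (isub' k P M)
isub' k P (ω₂ M)     = ω₂ (isub' k P M)
isub' k P (μ M)      = μ (isub' k (cshift' 0 1 P) M)
isub' k P (nam a M)  = nam a (isub' k P M)
isub' k P (star N)   = star N
isubE' k P (arg M)    = arg (isub' k P M)
isubE' k P π₁         = π₁
isubE' k P π₂         = π₂
isubE' k P (case M N) = case (isub' (suc k) (ishift' 0 1 P) M) (isub' (suc k) (ishift' 0 1 P) N)
isubE' k P (box b)    = box b

csub'  : ℕ → El' → Tm' → Tm'
csubE' : ℕ → El' → El' → El'
csub' k ε (var j)    = var j
csub' k ε (lam M)    = lam (csub' k (ishiftE' 0 1 ε) M)
csub' k ε (app M e)  = app (csub' k ε M) (csubE' k ε e)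
csub' k ε (pair M N) = pair (csub' k ε M) (csub' k ε N)
csub' k ε (ω₁ M)     = ω₁ (csub' k ε M)
csub' k ε (ω₂ M)     = ω₂ (csub' k ε M)
csub' k ε (μ M)      = μ (csub' (suc k) (cshiftE' 0 1 ε) M)
csub' k ε (nam a M)  = if a ≡ᵇ k then nam a (app (csub' k ε M) ε) else nam a (csub' k ε M)
csub' k ε (star N)   = star N
csubE' k ε (arg M)    = arg (csub' k ε M)
csubE' k ε π₁         = π₁
csubE' k ε π₂         = π₂
csubE' k ε (case M N) = case (csub' k (ishiftE' 0 1 ε) M) (csub' k (ishiftE' 0 1 ε) N)
csubE' k ε (box b)    = box b

emb  : Tm → Tm'
embE : El → El'
emb (var j)    = var j
emb (lam M)    = lam (emb M)
emb (app M e)  = app (emb M) (embE e)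
emb (pair M N) = pair (emb M) (emb N)
emb (ω₁ M)     = ω₁ (emb M)
emb (ω₂ M)     = ω₂ (emb M)
emb (μ M)      = μ (emb M)
emb (nam a M)  = nam a (emb M)
embE (arg M)    = arg (emb M)
embE π₁         = π₁
embE π₂         = π₂
embE (case M N) = case (emb M) (emb N)

boxEl : Box → El
boxEl (bt N) = arg N
boxEl bπ₁    = π₁
boxEl bπ₂    = π₂

-- weakening of a global (constant-containing) term to binder depth
-- (i intuitionistic, c classical binders)
wk : ℕ → ℕ → Tm → Tm
wk i c N = ishift 0 i (cshift 0 c N)

wkE : ℕ → ℕ → El → El
wkE i c e = ishiftE 0 i (cshiftE 0 c e)

data Red'  : ℕ → ℕ → Tm' → Tm' → Set
data RedE' : ℕ → ℕ → El' → El' → Set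
data RedB  : Box → Box → Set

data RedB where
  c-bt : ∀ {N N'} → N ⟶ N' → RedB (bt N) (bt N')

data Red' where
  β    : ∀ {i c M N} → Red' i c (app (lam M) (arg N)) (isub' 0 N M)
  proj₁ : ∀ {i c M₁ M₂} → Red' i c (app (pair M₁ M₂) π₁) M₁
  proj₂ : ∀ {i c M₁ M₂} → Red' i c (app (pair M₁ M₂) π₂) M₂
  inj₁ : ∀ {i c M N₁ N₂} → Red' i c (app (ω₁ M) (case N₁ N₂)) (isub' 0 M N₁)
  inj₂ : ∀ {i c M N₁ N₂} → Red' i c (app (ω₂ M) (case N₁ N₂)) (isub' 0 M N₂)
  comm : ∀ {i c M N₁ N₂ ε} →
         Red' i c (app (app M (case N₁ N₂)) ε)
                  (app M (case (app N₁ (ishiftE' 0 1 ε)) (app N₂ (ishiftE' 0 1 ε))))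
  μr   : ∀ {i c M ε} → Red' i c (app (μ M) ε) (μ (csub' 0 (cshiftE' 0 1 ε) M))
  unmark : ∀ {i c N b} →
         Red' i c (app (star N) (box b)) (app (emb (wk i c N)) (embE (wkE i c (boxEl b))))
  c-star  : ∀ {i c N N'} → N ⟶ N' → Red' i c (star N) (star N')
  c-lam   : ∀ {i c M M'} → Red' (suc i) c M M' → Red' i c (lam M) (lam M')
  c-appL  : ∀ {i c M M' e} → Red' i c M M' → Red' i c (app M e) (app M' e)
  c-appR  : ∀ {i c M e e'} → RedE' i c e e' → Red' i c (app M e) (app M e')
  c-pairL : ∀ {i c M M' N} → Red' i c M M' → Red' i c (pair M N) (pair M' N)
  c-pairR : ∀ {i c M N N'} → Red' i c N N' → Red' i c (pair M N) (pair M N')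
  c-ω₁    : ∀ {i c M M'} → Red' i c M M' → Red' i c (ω₁ M) (ω₁ M')
  c-ω₂    : ∀ {i c M M'} → Red' i c M M' → Red' i c (ω₂ M) (ω₂ M')
  c-μ     : ∀ {i c M M'} → Red' i (suc c) M M' → Red' i c (μ M) (μ M')
  c-nam   : ∀ {i c a M M'} → Red' i c M M' → Red' i c (nam a M) (nam a M')

data RedE' where
  c-arg   : ∀ {i c M M'} → Red' i c M M' → RedE' i c (arg M) (arg M')
  c-caseL : ∀ {i c M M' N} → Red' (suc i) c M M' → RedE' i c (case M N) (case M' N)
  c-caseR : ∀ {i c M N N'} → Red' (suc i) c N N' → RedE' i c (case M N) (case M N')
  c-box   : ∀ {i c b b'} → RedB b b' → RedE' i c (box b) (box b')

_⟶'_ : Tm' → Tm' → Set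
_⟶'_ = Red' 0 0

T₁at  : ℕ → ℕ → Tm' → Tm
T₁atE : ℕ → ℕ → El' → El
T₁at i c (var j)    = var j
T₁at i c (lam M)    = lam (T₁at (suc i) c M)
T₁at i c (app M e)  = app (T₁at i c M) (T₁atE i c e)
T₁at i c (pair M N) = pair (T₁at i c M) (T₁at i c N)
T₁at i c (ω₁ M)     = ω₁ (T₁at i c M)
T₁at i c (ω₂ M)     = ω₂ (T₁at i c M)
T₁at i c (μ M)      = μ (T₁at i (suc c) M)
T₁at i c (nam a M)  = nam a (T₁at i c M)
T₁at i c (star N)   = wk i c N
T₁atE i c (arg M)    = arg (T₁at i c M)
T₁atE i c π₁         = π₁
T₁atE i c π₂         = π₂
T₁atE i c (case M N) = case (T₁at (suc i) c M) (T₁at (suc i) c N)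
T₁atE i c (box b)    = wkE i c (boxEl b)

T₁ : Tm' → Tm
T₁ = T₁at 0 0

-- namedArgs k M : all N such that (a N) is a subterm of M, where a is the
-- classical variable with index k at the root of M
namedArgs  : ℕ → Tm' → List Tm'
namedArgsE : ℕ → El' → List Tm'
namedArgs k (var j)    = []
namedArgs k (lam M)    = namedArgs k M
namedArgs k (app M e)  = namedArgs k M ++ namedArgsE k e
namedArgs k (pair M N) = namedArgs k M ++ namedArgs k N
namedArgs k (ω₁ M)     = namedArgs k M
namedArgs k (ω₂ M)     = namedArgs k M
namedArgs k (μ M)      = namedArgs (suc k) M
namedArgs k (nam a M)  = (if a ≡ᵇ k then M ∷ [] else []) ++ namedArgs k M
namedArgs k (star N)   = []
namedArgsE k (arg M)    = namedArgs k M
namedArgsE k π₁         = []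
namedArgsE k π₂         = []
namedArgsE k (case M N) = namedArgs k M ++ namedArgs k N
namedArgsE k (box b)    = []

data Acceptable : Tm' → Set where
  acc⋆ : ∀ {N} → Acceptable (star N)
  accμ : ∀ {M} → All Acceptable (namedArgs 0 M) → Acceptable (μ M)
  acc[] : ∀ {N N₁ N₂} → Acceptable N₁ → Acceptable N₂ → Acceptable (app N (case N₁ N₂))

data Dir : Set where
  lamD appF appA pairL pairR ω₁D ω₂D μD namD argD caseL caseR : Dir

Pos : Set
Pos = List Dir

atT : Tm' → Pos → Maybe Tm'
atE : El' → Pos → Maybe Tm'
atT M []                    = just M
atT (lam M)    (lamD ∷ p)   = atT M p
atT (app M e)  (appF ∷ p)   = atT M p
atT (app M e)  (appA ∷ p)   = atE e p
atT (pair M N) (pairL ∷ p)  = atT M p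
atT (pair M N) (pairR ∷ p)  = atT N p
atT (ω₁ M)     (ω₁D ∷ p)    = atT M p
atT (ω₂ M)     (ω₂D ∷ p)    = atT M p
atT (μ M)      (μD ∷ p)     = atT M p
atT (nam a M)  (namD ∷ p)   = atT M p
atT _          (_ ∷ _)      = nothing
atE (arg M)    (argD ∷ p)   = atT M p
atE (case M N) (caseL ∷ p)  = atT M p
atE (case M N) (caseR ∷ p)  = atT N p
atE _          _            = nothing

-- st(U), as the set of positions (relative to U) of the occurrences N⋆
-- that belong to st(U)
stPos   : Tm' → List Pos
stNamed : ℕ → Tm' → List Pos
stNamedE : ℕ → El' → List Pos
stPos (star N)              = [ [] ]
stPos (μ M)                 = map (μD ∷_) (stNamed 0 M)
stPos (app N (case N₁ N₂))  = map (λ r → appA ∷ caseL ∷ r) (stPos N₁)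
                           ++ map (λ r → appA ∷ caseR ∷ r) (stPos N₂)
stPos _                     = []
stNamed k (var j)    = []
stNamed k (lam M)    = map (lamD ∷_) (stNamed k M)
stNamed k (app M e)  = map (appF ∷_) (stNamed k M) ++ map (appA ∷_) (stNamedE k e)
stNamed k (pair M N) = map (pairL ∷_) (stNamed k M) ++ map (pairR ∷_) (stNamed k N)
stNamed k (ω₁ M)     = map (ω₁D ∷_) (stNamed k M)
stNamed k (ω₂ M)     = map (ω₂D ∷_) (stNamed k M)
stNamed k (μ M)      = map (μD ∷_) (stNamed (suc k) M)
stNamed k (nam a M)  = (if a ≡ᵇ k then map (namD ∷_) (stPos M) else [])
                    ++ map (namD ∷_) (stNamed k M)
stNamed k (star N)   = []
stNamedE k (arg M)    = map (argD ∷_) (stNamed k M)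
stNamedE k π₁         = []
stNamedE k π₂         = []
stNamedE k (case M N) = map (caseL ∷_) (stNamed k M) ++ map (caseR ∷_) (stNamed k N)
stNamedE k (box b)    = []

record Correct (M : Tm') : Set where
  field
    -- (1) every occurrence of [ε] is in a subterm (U [ε]) with U acceptable
    --     (boxes only ever occur as the argument of an application)
    boxes : ∀ (p : Pos) (U : Tm') (b : Box) →
            atT M p ≡ just (app U (box b)) → Acceptable U
    -- (2) every occurrence of N⋆ lies in st(U) for some subterm (U [ε])
    stars : ∀ (p : Pos) (N : Tm) → atT M p ≡ just (star N) →
            Σ Pos λ q → Σ Tm' λ U → Σ Box λ b → Σ Pos λ r →
              (atT M q ≡ just (app U (box b))) × (r ∈ stPos U) × (p ≡ q ++ appF ∷ r)

-- Correctness refers to positions in the whole term. We replace it by a syntax-directed judgement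
-- Wf K s M which records, as a mode, whether a subterm lies in st(U) for an enclosing (U [ε]);
-- with all modes false it is equivalent to correctness. Wf is preserved by marked reduction:
-- substitutions only move subterms between positions of the same mode, a μ-reduction with a boxed
-- ε turns the st-arguments (a P) into ordinary arguments (a (P [ε])), and unmarking produces an
-- unmarked term. Wf also confines a marked term N⋆ to st-positions, so it is never the head of an
-- application other than (N⋆ [ε]). Hence every step of T₁ M is the image of the corresponding step
-- of M, except a step of T₁ (N⋆ [ε]) = (N ε) itself, which is simulated by unmarking first.

module Submission where

open import Defs
open import Data.Bool using (Bool; true; false; if_then_else_)
open import Data.Nat using (ℕ; zero; suc; _+_; _∸_; _<ᵇ_; _≡ᵇ_; _≤_; _<_; z≤n; s≤s; _<?_)
open import Data.Nat.Properties
open import Algebra.Properties.CommutativeSemigroup +-commutativeSemigroup using (xy∙z≈xz∙y)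
open import Data.Product using (Σ; _×_; _,_)
open import Function using (case_of_)
open import Data.List using ([]; _∷_; _++_; map)
open import Data.List.Membership.Propositional using (_∈_)
open import Data.List.Membership.Propositional.Properties using (∈-map⁺; ∈-map⁻; ∈-++⁺ˡ; ∈-++⁺ʳ; ∈-++⁻; map∷⁻)
open import Data.List.Relation.Unary.All using (All; []; _∷_)
import Data.List.Relation.Unary.All.Properties as All
open import Data.List.Relation.Unary.Any using (here)
open import Data.Sum using (inj₁; inj₂)
open import Data.Maybe using (just)
open import Relation.Binary.Definitions using (tri<; tri≈; tri>)
open import Relation.Nullary using (yes; no; contradiction)
open import Relation.Nullary.Reflects using (Reflects; ofʸ; ofⁿ; fromEquivalence)
open import Relation.Binary.PropositionalEquality using (_≡_; _≢_; refl; sym; trans; cong; cong₂; subst)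
open import Relation.Binary.Construct.Closure.Transitive using (TransClosure; [_]; _∷_)

≡ᵇ-reflects-≡ : ∀ m n → Reflects (m ≡ n) (m ≡ᵇ n)
≡ᵇ-reflects-≡ m n = fromEquivalence (≡ᵇ⇒≡ m n) (≡⇒≡ᵇ m n)

≢⇒≡ᵇ-false : ∀ {m n} → m ≢ n → (m ≡ᵇ n) ≡ false
≢⇒≡ᵇ-false {m} {n} m≢n with m ≡ᵇ n | ≡ᵇ-reflects-≡ m n
... | true  | ofʸ m≡n = contradiction m≡n m≢n
... | false | _       = refl

shiftVar-< : ∀ {k n j} → j < k → shiftVar k n j ≡ j
shiftVar-< {k} {n} {j} j<k with j <ᵇ k | <ᵇ-reflects-< j k
... | true  | _        = refl
... | false | ofⁿ j≮k = contradiction j<k j≮k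

shiftVar-≥ : ∀ {k n j} → k ≤ j → shiftVar k n j ≡ j + n
shiftVar-≥ {k} {n} {j} k≤j with j <ᵇ k | <ᵇ-reflects-< j k
... | false | _        = refl
... | true  | ofʸ j<k = contradiction k≤j (<⇒≱ j<k)

shiftVar-suc : ∀ k n j → shiftVar (suc k) n (suc j) ≡ suc (shiftVar k n j)
shiftVar-suc k n j with j <ᵇ k
... | true  = refl
... | false = refl

≤-shiftVar : ∀ k n j → j ≤ shiftVar k n j
≤-shiftVar k n j with j <? k
... | yes j<k rewrite shiftVar-< {k} {n} j<k = ≤-refl
... | no j≮k  rewrite shiftVar-≥ {k} {n} (≮⇒≥ j≮k) = m≤m+n j n

shiftVar-comm : ∀ {m k} n c → m ≤ k → ∀ j →
                shiftVar (k + c) n (shiftVar m c j) ≡ shiftVar m c (shiftVar k n j)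
shiftVar-comm {m} {k} n c m≤k j with j <? m | j <? k
... | yes j<m | _
  rewrite shiftVar-< {k} {n} (<-≤-trans j<m m≤k) | shiftVar-< {m} {c} j<m
  = shiftVar-< (<-≤-trans j<m (≤-trans m≤k (m≤m+n k c)))
... | no j≮m | yes j<k
  rewrite shiftVar-< {k} {n} j<k | shiftVar-≥ {m} {c} (≮⇒≥ j≮m)
  = shiftVar-< (+-monoˡ-< c j<k)
... | no j≮m | no j≮k
  rewrite shiftVar-≥ {k} {n} (≮⇒≥ j≮k) | shiftVar-≥ {m} {c} (≮⇒≥ j≮m)
        | shiftVar-≥ {m} {c} (≤-trans (≮⇒≥ j≮m) (m≤m+n j n))
  = trans (shiftVar-≥ (+-monoˡ-≤ c (≮⇒≥ j≮k))) (xy∙z≈xz∙y j c n)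

shiftVar-fuse : ∀ {m k} i n → m ≤ k → k ≤ m + i → ∀ j →
                shiftVar k n (shiftVar m i j) ≡ shiftVar m (i + n) j
shiftVar-fuse {m} {k} i n m≤k k≤m+i j with j <? m
... | yes j<m rewrite shiftVar-< {m} {i} j<m | shiftVar-< {m} {i + n} j<m = shiftVar-< (<-≤-trans j<m m≤k)
... | no j≮m  rewrite shiftVar-≥ {m} {i} (≮⇒≥ j≮m) | shiftVar-≥ {m} {i + n} (≮⇒≥ j≮m) =
  trans (shiftVar-≥ (≤-trans k≤m+i (+-monoˡ-≤ i (≮⇒≥ j≮m)))) (+-assoc j i n)

substVar-< : ∀ {j x} Q → x < j → substVar j Q x ≡ var x
substVar-< {j} {x} Q x<j with x ≡ᵇ j | ≡ᵇ-reflects-≡ x j | x <ᵇ j | <ᵇ-reflects-< x j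
... | true  | ofʸ refl | _     | _       = contradiction x<j (<-irrefl refl)
... | false | _        | true  | _       = refl
... | false | _        | false | ofⁿ x≮j = contradiction x<j x≮j

substVar-≡ : ∀ j Q → substVar j Q j ≡ Q
substVar-≡ j Q with j ≡ᵇ j | ≡ᵇ-reflects-≡ j j
... | true  | _       = refl
... | false | ofⁿ j≢j = contradiction refl j≢j

substVar-> : ∀ {j x} Q → j < x → substVar j Q x ≡ var (x ∸ 1)
substVar-> {j} {x} Q j<x with x ≡ᵇ j | ≡ᵇ-reflects-≡ x j | x <ᵇ j | <ᵇ-reflects-< x j
... | true  | ofʸ refl | _     | _       = contradiction j<x (<-irrefl refl)
... | false | _        | true  | ofʸ x<j = contradiction x<j (<⇒≯ j<x)
... | false | _        | false | _       = refl

shiftVar-≡ᵇ-below : ∀ {j k} n a → j < k → (shiftVar k n a ≡ᵇ j) ≡ (a ≡ᵇ j)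
shiftVar-≡ᵇ-below {j} {k} n a j<k with a <? k
... | yes a<k rewrite shiftVar-< {k} {n} a<k = refl
... | no a≮k  rewrite shiftVar-≥ {k} {n} (≮⇒≥ a≮k) =
  trans (≢⇒≡ᵇ-false (>⇒≢ (<-≤-trans j<k (≤-trans (≮⇒≥ a≮k) (m≤m+n a n)))))
        (sym (≢⇒≡ᵇ-false (>⇒≢ (<-≤-trans j<k (≮⇒≥ a≮k)))))

shiftVar-≡ᵇ-gap : ∀ {j k} d a → j ≤ k → k < j + d → (shiftVar j d a ≡ᵇ k) ≡ false
shiftVar-≡ᵇ-gap {j} {k} d a j≤k k<j+d with a <? j
... | yes a<j rewrite shiftVar-< {j} {d} a<j = ≢⇒≡ᵇ-false (<⇒≢ (<-≤-trans a<j j≤k))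
... | no a≮j  rewrite shiftVar-≥ {j} {d} (≮⇒≥ a≮j) =
  ≢⇒≡ᵇ-false (>⇒≢ (<-≤-trans k<j+d (+-monoˡ-≤ d (≮⇒≥ a≮j))))

substVar-shiftVar-gap : ∀ {m k} d P x → m ≤ k → k ≤ m + d →
                        substVar k P (shiftVar m (suc d) x) ≡ var (shiftVar m d x)
substVar-shiftVar-gap {m} {k} d P x m≤k k≤m+d with x <? m
... | yes x<m rewrite shiftVar-< {m} {suc d} x<m | shiftVar-< {m} {d} x<m = substVar-< P (<-≤-trans x<m m≤k)
... | no x≮m
  rewrite shiftVar-≥ {m} {suc d} (≮⇒≥ x≮m) | shiftVar-≥ {m} {d} (≮⇒≥ x≮m) | +-suc x d =
  substVar-> P (s≤s (≤-trans k≤m+d (+-monoˡ-≤ d (≮⇒≥ x≮m))))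

ishift-substVar : ∀ {j k} n Q x → j ≤ k →
                  ishift k n (substVar j Q x) ≡ substVar j (ishift k n Q) (shiftVar (suc k) n x)
ishift-substVar {j} {k} n Q x j≤k with <-cmp x j
... | tri< x<j _ _
  rewrite substVar-< Q x<j | shiftVar-< {suc k} {n} (<-≤-trans x<j (m≤n⇒m≤1+n j≤k))
        | substVar-< (ishift k n Q) x<j
  = cong var (shiftVar-< (<-≤-trans x<j j≤k))
... | tri≈ _ refl _
  rewrite substVar-≡ j Q | shiftVar-< {suc k} {n} (s≤s j≤k) = sym (substVar-≡ j _)
ishift-substVar {j} {k} n Q (suc x) j≤k | tri> _ _ j<x
  rewrite substVar-> Q j<x | shiftVar-suc k n x
        | substVar-> (ishift k n Q) (≤-trans j<x (s≤s (≤-shiftVar k n x)))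
  = refl

cshift-substVar : ∀ k n j Q x → cshift k n (substVar j Q x) ≡ substVar j (cshift k n Q) x
cshift-substVar k n j Q x with x ≡ᵇ j | x <ᵇ j
... | true  | _     = refl
... | false | true  = refl
... | false | false = refl

ishift-ishift-comm  : ∀ {m k} n c → m ≤ k → ∀ X →
                      ishift (k + c) n (ishift m c X) ≡ ishift m c (ishift k n X)
ishiftE-ishiftE-comm : ∀ {m k} n c → m ≤ k → ∀ e →
                      ishiftE (k + c) n (ishiftE m c e) ≡ ishiftE m c (ishiftE k n e)
ishift-ishift-comm n c m≤k (var j)    = cong var (shiftVar-comm n c m≤k j)
ishift-ishift-comm n c m≤k (lam X)    = cong lam (ishift-ishift-comm n c (s≤s m≤k) X)
ishift-ishift-comm n c m≤k (app X e)  =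
  cong₂ app (ishift-ishift-comm n c m≤k X) (ishiftE-ishiftE-comm n c m≤k e)
ishift-ishift-comm n c m≤k (pair X Y) = cong₂ pair (ishift-ishift-comm n c m≤k X) (ishift-ishift-comm n c m≤k Y)
ishift-ishift-comm n c m≤k (ω₁ X)     = cong ω₁ (ishift-ishift-comm n c m≤k X)
ishift-ishift-comm n c m≤k (ω₂ X)     = cong ω₂ (ishift-ishift-comm n c m≤k X)
ishift-ishift-comm n c m≤k (μ X)      = cong μ (ishift-ishift-comm n c m≤k X)
ishift-ishift-comm n c m≤k (nam a X)  = cong (nam a) (ishift-ishift-comm n c m≤k X)
ishiftE-ishiftE-comm n c m≤k (arg X)    = cong arg (ishift-ishift-comm n c m≤k X)
ishiftE-ishiftE-comm n c m≤k π₁         = refl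
ishiftE-ishiftE-comm n c m≤k π₂         = refl
ishiftE-ishiftE-comm n c m≤k (case X Y) =
  cong₂ case (ishift-ishift-comm n c (s≤s m≤k) X) (ishift-ishift-comm n c (s≤s m≤k) Y)

cshift-cshift-comm  : ∀ {m k} n c → m ≤ k → ∀ X →
                      cshift (k + c) n (cshift m c X) ≡ cshift m c (cshift k n X)
cshiftE-cshiftE-comm : ∀ {m k} n c → m ≤ k → ∀ e →
                      cshiftE (k + c) n (cshiftE m c e) ≡ cshiftE m c (cshiftE k n e)
cshift-cshift-comm n c m≤k (var j)    = refl
cshift-cshift-comm n c m≤k (lam X)    = cong lam (cshift-cshift-comm n c m≤k X)
cshift-cshift-comm n c m≤k (app X e)  =
  cong₂ app (cshift-cshift-comm n c m≤k X) (cshiftE-cshiftE-comm n c m≤k e)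
cshift-cshift-comm n c m≤k (pair X Y) = cong₂ pair (cshift-cshift-comm n c m≤k X) (cshift-cshift-comm n c m≤k Y)
cshift-cshift-comm n c m≤k (ω₁ X)     = cong ω₁ (cshift-cshift-comm n c m≤k X)
cshift-cshift-comm n c m≤k (ω₂ X)     = cong ω₂ (cshift-cshift-comm n c m≤k X)
cshift-cshift-comm n c m≤k (μ X)      = cong μ (cshift-cshift-comm n c (s≤s m≤k) X)
cshift-cshift-comm n c m≤k (nam a X)  = cong₂ nam (shiftVar-comm n c m≤k a) (cshift-cshift-comm n c m≤k X)
cshiftE-cshiftE-comm n c m≤k (arg X)    = cong arg (cshift-cshift-comm n c m≤k X)
cshiftE-cshiftE-comm n c m≤k π₁         = refl
cshiftE-cshiftE-comm n c m≤k π₂         = refl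
cshiftE-cshiftE-comm n c m≤k (case X Y) =
  cong₂ case (cshift-cshift-comm n c m≤k X) (cshift-cshift-comm n c m≤k Y)

ishift-cshift-comm  : ∀ k n j m X → ishift k n (cshift j m X) ≡ cshift j m (ishift k n X)
ishiftE-cshiftE-comm : ∀ k n j m e → ishiftE k n (cshiftE j m e) ≡ cshiftE j m (ishiftE k n e)
ishift-cshift-comm k n j m (var x)    = refl
ishift-cshift-comm k n j m (lam X)    = cong lam (ishift-cshift-comm (suc k) n j m X)
ishift-cshift-comm k n j m (app X e)  = cong₂ app (ishift-cshift-comm k n j m X) (ishiftE-cshiftE-comm k n j m e)
ishift-cshift-comm k n j m (pair X Y) = cong₂ pair (ishift-cshift-comm k n j m X) (ishift-cshift-comm k n j m Y)
ishift-cshift-comm k n j m (ω₁ X)     = cong ω₁ (ishift-cshift-comm k n j m X)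
ishift-cshift-comm k n j m (ω₂ X)     = cong ω₂ (ishift-cshift-comm k n j m X)
ishift-cshift-comm k n j m (μ X)      = cong μ (ishift-cshift-comm k n (suc j) m X)
ishift-cshift-comm k n j m (nam a X)  = cong (nam _) (ishift-cshift-comm k n j m X)
ishiftE-cshiftE-comm k n j m (arg X)    = cong arg (ishift-cshift-comm k n j m X)
ishiftE-cshiftE-comm k n j m π₁         = refl
ishiftE-cshiftE-comm k n j m π₂         = refl
ishiftE-cshiftE-comm k n j m (case X Y) =
  cong₂ case (ishift-cshift-comm (suc k) n j m X) (ishift-cshift-comm (suc k) n j m Y)

ishift-ishift₁ : ∀ k n X → ishift (suc k) n (ishift 0 1 X) ≡ ishift 0 1 (ishift k n X)
ishift-ishift₁ k n X rewrite sym (+-comm k 1) = ishift-ishift-comm n 1 z≤n X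

ishiftE-ishiftE₁ : ∀ k n e → ishiftE (suc k) n (ishiftE 0 1 e) ≡ ishiftE 0 1 (ishiftE k n e)
ishiftE-ishiftE₁ k n e rewrite sym (+-comm k 1) = ishiftE-ishiftE-comm n 1 z≤n e

cshift-cshift₁ : ∀ k n X → cshift (suc k) n (cshift 0 1 X) ≡ cshift 0 1 (cshift k n X)
cshift-cshift₁ k n X rewrite sym (+-comm k 1) = cshift-cshift-comm n 1 z≤n X

cshiftE-cshiftE₁ : ∀ k n e → cshiftE (suc k) n (cshiftE 0 1 e) ≡ cshiftE 0 1 (cshiftE k n e)
cshiftE-cshiftE₁ k n e rewrite sym (+-comm k 1) = cshiftE-cshiftE-comm n 1 z≤n e

ishift-ishift-fuse  : ∀ {m k} i n X → m ≤ k → k ≤ m + i →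
                      ishift k n (ishift m i X) ≡ ishift m (i + n) X
ishiftE-ishiftE-fuse : ∀ {m k} i n e → m ≤ k → k ≤ m + i →
                      ishiftE k n (ishiftE m i e) ≡ ishiftE m (i + n) e
ishift-ishift-fuse i n (var j)    p q = cong var (shiftVar-fuse i n p q j)
ishift-ishift-fuse i n (lam X)    p q = cong lam (ishift-ishift-fuse i n X (s≤s p) (s≤s q))
ishift-ishift-fuse i n (app X e)  p q = cong₂ app (ishift-ishift-fuse i n X p q) (ishiftE-ishiftE-fuse i n e p q)
ishift-ishift-fuse i n (pair X Y) p q = cong₂ pair (ishift-ishift-fuse i n X p q) (ishift-ishift-fuse i n Y p q)
ishift-ishift-fuse i n (ω₁ X)     p q = cong ω₁ (ishift-ishift-fuse i n X p q)
ishift-ishift-fuse i n (ω₂ X)     p q = cong ω₂ (ishift-ishift-fuse i n X p q)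
ishift-ishift-fuse i n (μ X)      p q = cong μ (ishift-ishift-fuse i n X p q)
ishift-ishift-fuse i n (nam a X)  p q = cong (nam a) (ishift-ishift-fuse i n X p q)
ishiftE-ishiftE-fuse i n (arg X)    p q = cong arg (ishift-ishift-fuse i n X p q)
ishiftE-ishiftE-fuse i n π₁         p q = refl
ishiftE-ishiftE-fuse i n π₂         p q = refl
ishiftE-ishiftE-fuse i n (case X Y) p q =
  cong₂ case (ishift-ishift-fuse i n X (s≤s p) (s≤s q)) (ishift-ishift-fuse i n Y (s≤s p) (s≤s q))

cshift-cshift-fuse  : ∀ {m k} i n X → m ≤ k → k ≤ m + i →
                      cshift k n (cshift m i X) ≡ cshift m (i + n) X
cshiftE-cshiftE-fuse : ∀ {m k} i n e → m ≤ k → k ≤ m + i →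
                      cshiftE k n (cshiftE m i e) ≡ cshiftE m (i + n) e
cshift-cshift-fuse i n (var j)    p q = refl
cshift-cshift-fuse i n (lam X)    p q = cong lam (cshift-cshift-fuse i n X p q)
cshift-cshift-fuse i n (app X e)  p q = cong₂ app (cshift-cshift-fuse i n X p q) (cshiftE-cshiftE-fuse i n e p q)
cshift-cshift-fuse i n (pair X Y) p q = cong₂ pair (cshift-cshift-fuse i n X p q) (cshift-cshift-fuse i n Y p q)
cshift-cshift-fuse i n (ω₁ X)     p q = cong ω₁ (cshift-cshift-fuse i n X p q)
cshift-cshift-fuse i n (ω₂ X)     p q = cong ω₂ (cshift-cshift-fuse i n X p q)
cshift-cshift-fuse i n (μ X)      p q = cong μ (cshift-cshift-fuse i n X (s≤s p) (s≤s q))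
cshift-cshift-fuse i n (nam a X)  p q = cong₂ nam (shiftVar-fuse i n p q a) (cshift-cshift-fuse i n X p q)
cshiftE-cshiftE-fuse i n (arg X)    p q = cong arg (cshift-cshift-fuse i n X p q)
cshiftE-cshiftE-fuse i n π₁         p q = refl
cshiftE-cshiftE-fuse i n π₂         p q = refl
cshiftE-cshiftE-fuse i n (case X Y) p q = cong₂ case (cshift-cshift-fuse i n X p q) (cshift-cshift-fuse i n Y p q)

ishift-isub  : ∀ {j k} n Q P → j ≤ k →
               ishift k n (isub j Q P) ≡ isub j (ishift k n Q) (ishift (suc k) n P)
ishiftE-isubE : ∀ {j k} n Q e → j ≤ k →
               ishiftE k n (isubE j Q e) ≡ isubE j (ishift k n Q) (ishiftE (suc k) n e)
ishift-isub n Q (var x)    p = ishift-substVar n Q x p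
ishift-isub {k = k} n Q (lam P) p rewrite sym (ishift-ishift₁ k n Q) =
  cong lam (ishift-isub n (ishift 0 1 Q) P (s≤s p))
ishift-isub n Q (app P e)  p = cong₂ app (ishift-isub n Q P p) (ishiftE-isubE n Q e p)
ishift-isub n Q (pair P R) p = cong₂ pair (ishift-isub n Q P p) (ishift-isub n Q R p)
ishift-isub n Q (ω₁ P)     p = cong ω₁ (ishift-isub n Q P p)
ishift-isub n Q (ω₂ P)     p = cong ω₂ (ishift-isub n Q P p)
ishift-isub {k = k} n Q (μ P) p rewrite sym (ishift-cshift-comm k n 0 1 Q) =
  cong μ (ishift-isub n (cshift 0 1 Q) P p)
ishift-isub n Q (nam a P)  p = cong (nam a) (ishift-isub n Q P p)
ishiftE-isubE n Q (arg P) p = cong arg (ishift-isub n Q P p)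
ishiftE-isubE n Q π₁      p = refl
ishiftE-isubE n Q π₂      p = refl
ishiftE-isubE {k = k} n Q (case P R) p rewrite sym (ishift-ishift₁ k n Q) =
  cong₂ case (ishift-isub n (ishift 0 1 Q) P (s≤s p)) (ishift-isub n (ishift 0 1 Q) R (s≤s p))

cshift-isub  : ∀ k n j Q P → cshift k n (isub j Q P) ≡ isub j (cshift k n Q) (cshift k n P)
cshiftE-isubE : ∀ k n j Q e → cshiftE k n (isubE j Q e) ≡ isubE j (cshift k n Q) (cshiftE k n e)
cshift-isub k n j Q (var x)    = cshift-substVar k n j Q x
cshift-isub k n j Q (lam P)    rewrite ishift-cshift-comm 0 1 k n Q =
  cong lam (cshift-isub k n (suc j) (ishift 0 1 Q) P)
cshift-isub k n j Q (app P e)  = cong₂ app (cshift-isub k n j Q P) (cshiftE-isubE k n j Q e)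
cshift-isub k n j Q (pair P R) = cong₂ pair (cshift-isub k n j Q P) (cshift-isub k n j Q R)
cshift-isub k n j Q (ω₁ P)     = cong ω₁ (cshift-isub k n j Q P)
cshift-isub k n j Q (ω₂ P)     = cong ω₂ (cshift-isub k n j Q P)
cshift-isub k n j Q (μ P)      rewrite sym (cshift-cshift₁ k n Q) =
  cong μ (cshift-isub (suc k) n j (cshift 0 1 Q) P)
cshift-isub k n j Q (nam a P)  = cong (nam _) (cshift-isub k n j Q P)
cshiftE-isubE k n j Q (arg P)    = cong arg (cshift-isub k n j Q P)
cshiftE-isubE k n j Q π₁         = refl
cshiftE-isubE k n j Q π₂         = refl
cshiftE-isubE k n j Q (case P R) rewrite ishift-cshift-comm 0 1 k n Q =
  cong₂ case (cshift-isub k n (suc j) (ishift 0 1 Q) P) (cshift-isub k n (suc j) (ishift 0 1 Q) R)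

ishift-csub  : ∀ k n j ε P → ishift k n (csub j ε P) ≡ csub j (ishiftE k n ε) (ishift k n P)
ishiftE-csubE : ∀ k n j ε e → ishiftE k n (csubE j ε e) ≡ csubE j (ishiftE k n ε) (ishiftE k n e)
ishift-csub k n j ε (var x)    = refl
ishift-csub k n j ε (lam P)    rewrite sym (ishiftE-ishiftE₁ k n ε) =
  cong lam (ishift-csub (suc k) n j (ishiftE 0 1 ε) P)
ishift-csub k n j ε (app P e)  = cong₂ app (ishift-csub k n j ε P) (ishiftE-csubE k n j ε e)
ishift-csub k n j ε (pair P R) = cong₂ pair (ishift-csub k n j ε P) (ishift-csub k n j ε R)
ishift-csub k n j ε (ω₁ P)     = cong ω₁ (ishift-csub k n j ε P)
ishift-csub k n j ε (ω₂ P)     = cong ω₂ (ishift-csub k n j ε P)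
ishift-csub k n j ε (μ P)      rewrite sym (ishiftE-cshiftE-comm k n 0 1 ε) =
  cong μ (ishift-csub k n (suc j) (cshiftE 0 1 ε) P)
ishift-csub k n j ε (nam a P) with a ≡ᵇ j
... | true  = cong (nam a) (cong₂ app (ishift-csub k n j ε P) refl)
... | false = cong (nam a) (ishift-csub k n j ε P)
ishiftE-csubE k n j ε (arg P)    = cong arg (ishift-csub k n j ε P)
ishiftE-csubE k n j ε π₁         = refl
ishiftE-csubE k n j ε π₂         = refl
ishiftE-csubE k n j ε (case P R) rewrite sym (ishiftE-ishiftE₁ k n ε) =
  cong₂ case (ishift-csub (suc k) n j (ishiftE 0 1 ε) P) (ishift-csub (suc k) n j (ishiftE 0 1 ε) R)

cshift-csub  : ∀ {j k} n ε P → j < k → cshift k n (csub j ε P) ≡ csub j (cshiftE k n ε) (cshift k n P)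
cshiftE-csubE : ∀ {j k} n ε e → j < k → cshiftE k n (csubE j ε e) ≡ csubE j (cshiftE k n ε) (cshiftE k n e)
cshift-csub n ε (var x)    p = refl
cshift-csub {k = k} n ε (lam P) p rewrite ishiftE-cshiftE-comm 0 1 k n ε =
  cong lam (cshift-csub n (ishiftE 0 1 ε) P p)
cshift-csub n ε (app P e)  p = cong₂ app (cshift-csub n ε P p) (cshiftE-csubE n ε e p)
cshift-csub n ε (pair P R) p = cong₂ pair (cshift-csub n ε P p) (cshift-csub n ε R p)
cshift-csub n ε (ω₁ P)     p = cong ω₁ (cshift-csub n ε P p)
cshift-csub n ε (ω₂ P)     p = cong ω₂ (cshift-csub n ε P p)
cshift-csub {k = k} n ε (μ P) p rewrite sym (cshiftE-cshiftE₁ k n ε) =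
  cong μ (cshift-csub n (cshiftE 0 1 ε) P (s≤s p))
cshift-csub {j} n ε (nam a P) p rewrite shiftVar-≡ᵇ-below n a p with a ≡ᵇ j
... | true  = cong (nam _) (cong₂ app (cshift-csub n ε P p) refl)
... | false = cong (nam _) (cshift-csub n ε P p)
cshiftE-csubE n ε (arg P)    p = cong arg (cshift-csub n ε P p)
cshiftE-csubE n ε π₁         p = refl
cshiftE-csubE n ε π₂         p = refl
cshiftE-csubE {k = k} n ε (case P R) p rewrite ishiftE-cshiftE-comm 0 1 k n ε =
  cong₂ case (cshift-csub n (ishiftE 0 1 ε) P p) (cshift-csub n (ishiftE 0 1 ε) R p)

isub-ishift  : ∀ {m k} d P Y → m ≤ k → k ≤ m + d → isub k P (ishift m (suc d) Y) ≡ ishift m d Y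
isubE-ishiftE : ∀ {m k} d P e → m ≤ k → k ≤ m + d → isubE k P (ishiftE m (suc d) e) ≡ ishiftE m d e
isub-ishift d P (var x)    p q = substVar-shiftVar-gap d P x p q
isub-ishift d P (lam Y)    p q = cong lam (isub-ishift d (ishift 0 1 P) Y (s≤s p) (s≤s q))
isub-ishift d P (app Y e)  p q = cong₂ app (isub-ishift d P Y p q) (isubE-ishiftE d P e p q)
isub-ishift d P (pair Y Z) p q = cong₂ pair (isub-ishift d P Y p q) (isub-ishift d P Z p q)
isub-ishift d P (ω₁ Y)     p q = cong ω₁ (isub-ishift d P Y p q)
isub-ishift d P (ω₂ Y)     p q = cong ω₂ (isub-ishift d P Y p q)
isub-ishift d P (μ Y)      p q = cong μ (isub-ishift d (cshift 0 1 P) Y p q)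
isub-ishift d P (nam a Y)  p q = cong (nam a) (isub-ishift d P Y p q)
isubE-ishiftE d P (arg Y)    p q = cong arg (isub-ishift d P Y p q)
isubE-ishiftE d P π₁         p q = refl
isubE-ishiftE d P π₂         p q = refl
isubE-ishiftE d P (case Y Z) p q =
  cong₂ case (isub-ishift d (ishift 0 1 P) Y (s≤s p) (s≤s q)) (isub-ishift d (ishift 0 1 P) Z (s≤s p) (s≤s q))

csub-ishift-cshift  : ∀ {j k} d m n ε N → j ≤ k → k < j + d →
                      csub k ε (ishift m n (cshift j d N)) ≡ ishift m n (cshift j d N)
csubE-ishiftE-cshiftE : ∀ {j k} d m n ε e → j ≤ k → k < j + d →
                      csubE k ε (ishiftE m n (cshiftE j d e)) ≡ ishiftE m n (cshiftE j d e)
csub-ishift-cshift d m n ε (var x)    p q = refl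
csub-ishift-cshift d m n ε (lam N)    p q = cong lam (csub-ishift-cshift d (suc m) n (ishiftE 0 1 ε) N p q)
csub-ishift-cshift d m n ε (app N e)  p q =
  cong₂ app (csub-ishift-cshift d m n ε N p q) (csubE-ishiftE-cshiftE d m n ε e p q)
csub-ishift-cshift d m n ε (pair N R) p q =
  cong₂ pair (csub-ishift-cshift d m n ε N p q) (csub-ishift-cshift d m n ε R p q)
csub-ishift-cshift d m n ε (ω₁ N)     p q = cong ω₁ (csub-ishift-cshift d m n ε N p q)
csub-ishift-cshift d m n ε (ω₂ N)     p q = cong ω₂ (csub-ishift-cshift d m n ε N p q)
csub-ishift-cshift d m n ε (μ N)      p q = cong μ (csub-ishift-cshift d m n (cshiftE 0 1 ε) N (s≤s p) (s≤s q))
csub-ishift-cshift d m n ε (nam a N)  p q rewrite shiftVar-≡ᵇ-gap d a p q =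
  cong (nam _) (csub-ishift-cshift d m n ε N p q)
csubE-ishiftE-cshiftE d m n ε (arg N)    p q = cong arg (csub-ishift-cshift d m n ε N p q)
csubE-ishiftE-cshiftE d m n ε π₁         p q = refl
csubE-ishiftE-cshiftE d m n ε π₂         p q = refl
csubE-ishiftE-cshiftE d m n ε (case N R) p q =
  cong₂ case (csub-ishift-cshift d (suc m) n (ishiftE 0 1 ε) N p q)
             (csub-ishift-cshift d (suc m) n (ishiftE 0 1 ε) R p q)

-- Shifts reflect reduction

ishift-reflects-⟶  : ∀ k n X {R} → ishift k n X ⟶ R → Σ Tm λ X' → X ⟶ X' × R ≡ ishift k n X'
ishiftE-reflects-⟶E : ∀ k n e {R} → ishiftE k n e ⟶E R → Σ El λ e' → e ⟶E e' × R ≡ ishiftE k n e'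
ishift-reflects-⟶ k n (app (lam P) (arg Q)) β = isub 0 Q P , β , sym (ishift-isub n Q P z≤n)
ishift-reflects-⟶ k n (app (pair A B) π₁) proj₁ = A , proj₁ , refl
ishift-reflects-⟶ k n (app (pair A B) π₂) proj₂ = B , proj₂ , refl
ishift-reflects-⟶ k n (app (ω₁ M) (case N₁ N₂)) inj₁ = isub 0 M N₁ , inj₁ , sym (ishift-isub n M N₁ z≤n)
ishift-reflects-⟶ k n (app (ω₂ M) (case N₁ N₂)) inj₂ = isub 0 M N₂ , inj₂ , sym (ishift-isub n M N₂ z≤n)
ishift-reflects-⟶ k n (app (app M (case N₁ N₂)) e) comm =
  _ , comm , cong (λ ε → app _ (case (app _ ε) (app _ ε))) (sym (ishiftE-ishiftE₁ k n e))
ishift-reflects-⟶ k n (app (μ M) e) μr =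
  _ , μr , cong μ (sym (trans (ishift-csub k n 0 (cshiftE 0 1 e) M)
                              (cong (λ ε → csub 0 ε (ishift k n M)) (ishiftE-cshiftE-comm k n 0 1 e))))
ishift-reflects-⟶ k n (lam X) (c-lam r) with ishift-reflects-⟶ (suc k) n X r
... | X' , r' , refl = lam X' , c-lam r' , refl
ishift-reflects-⟶ k n (app X e) (c-appL r) with ishift-reflects-⟶ k n X r
... | X' , r' , refl = app X' e , c-appL r' , refl
ishift-reflects-⟶ k n (app X e) (c-appR r) with ishiftE-reflects-⟶E k n e r
... | e' , r' , refl = app X e' , c-appR r' , refl
ishift-reflects-⟶ k n (pair X Y) (c-pairL r) with ishift-reflects-⟶ k n X r
... | X' , r' , refl = pair X' Y , c-pairL r' , refl
ishift-reflects-⟶ k n (pair X Y) (c-pairR r) with ishift-reflects-⟶ k n Y r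
... | Y' , r' , refl = pair X Y' , c-pairR r' , refl
ishift-reflects-⟶ k n (ω₁ X) (c-ω₁ r) with ishift-reflects-⟶ k n X r
... | X' , r' , refl = ω₁ X' , c-ω₁ r' , refl
ishift-reflects-⟶ k n (ω₂ X) (c-ω₂ r) with ishift-reflects-⟶ k n X r
... | X' , r' , refl = ω₂ X' , c-ω₂ r' , refl
ishift-reflects-⟶ k n (μ X) (c-μ r) with ishift-reflects-⟶ k n X r
... | X' , r' , refl = μ X' , c-μ r' , refl
ishift-reflects-⟶ k n (nam a X) (c-nam r) with ishift-reflects-⟶ k n X r
... | X' , r' , refl = nam a X' , c-nam r' , refl
ishiftE-reflects-⟶E k n (arg X) (c-arg r) with ishift-reflects-⟶ k n X r
... | X' , r' , refl = arg X' , c-arg r' , refl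
ishiftE-reflects-⟶E k n (case X Y) (c-caseL r) with ishift-reflects-⟶ (suc k) n X r
... | X' , r' , refl = case X' Y , c-caseL r' , refl
ishiftE-reflects-⟶E k n (case X Y) (c-caseR r) with ishift-reflects-⟶ (suc k) n Y r
... | Y' , r' , refl = case X Y' , c-caseR r' , refl

cshift-reflects-⟶  : ∀ k n X {R} → cshift k n X ⟶ R → Σ Tm λ X' → X ⟶ X' × R ≡ cshift k n X'
cshiftE-reflects-⟶E : ∀ k n e {R} → cshiftE k n e ⟶E R → Σ El λ e' → e ⟶E e' × R ≡ cshiftE k n e'
cshift-reflects-⟶ k n (app (lam P) (arg Q)) β = isub 0 Q P , β , sym (cshift-isub k n 0 Q P)
cshift-reflects-⟶ k n (app (pair A B) π₁) proj₁ = A , proj₁ , refl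
cshift-reflects-⟶ k n (app (pair A B) π₂) proj₂ = B , proj₂ , refl
cshift-reflects-⟶ k n (app (ω₁ M) (case N₁ N₂)) inj₁ = isub 0 M N₁ , inj₁ , sym (cshift-isub k n 0 M N₁)
cshift-reflects-⟶ k n (app (ω₂ M) (case N₁ N₂)) inj₂ = isub 0 M N₂ , inj₂ , sym (cshift-isub k n 0 M N₂)
cshift-reflects-⟶ k n (app (app M (case N₁ N₂)) e) comm =
  _ , comm , cong (λ ε → app _ (case (app _ ε) (app _ ε))) (ishiftE-cshiftE-comm 0 1 k n e)
cshift-reflects-⟶ k n (app (μ M) e) μr =
  _ , μr , cong μ (sym (trans (cshift-csub n (cshiftE 0 1 e) M (s≤s z≤n))
                              (cong (λ ε → csub 0 ε (cshift (suc k) n M)) (cshiftE-cshiftE₁ k n e))))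
cshift-reflects-⟶ k n (lam X) (c-lam r) with cshift-reflects-⟶ k n X r
... | X' , r' , refl = lam X' , c-lam r' , refl
cshift-reflects-⟶ k n (app X e) (c-appL r) with cshift-reflects-⟶ k n X r
... | X' , r' , refl = app X' e , c-appL r' , refl
cshift-reflects-⟶ k n (app X e) (c-appR r) with cshiftE-reflects-⟶E k n e r
... | e' , r' , refl = app X e' , c-appR r' , refl
cshift-reflects-⟶ k n (pair X Y) (c-pairL r) with cshift-reflects-⟶ k n X r
... | X' , r' , refl = pair X' Y , c-pairL r' , refl
cshift-reflects-⟶ k n (pair X Y) (c-pairR r) with cshift-reflects-⟶ k n Y r
... | Y' , r' , refl = pair X Y' , c-pairR r' , refl
cshift-reflects-⟶ k n (ω₁ X) (c-ω₁ r) with cshift-reflects-⟶ k n X r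
... | X' , r' , refl = ω₁ X' , c-ω₁ r' , refl
cshift-reflects-⟶ k n (ω₂ X) (c-ω₂ r) with cshift-reflects-⟶ k n X r
... | X' , r' , refl = ω₂ X' , c-ω₂ r' , refl
cshift-reflects-⟶ k n (μ X) (c-μ r) with cshift-reflects-⟶ (suc k) n X r
... | X' , r' , refl = μ X' , c-μ r' , refl
cshift-reflects-⟶ k n (nam a X) (c-nam r) with cshift-reflects-⟶ k n X r
... | X' , r' , refl = nam a X' , c-nam r' , refl
cshiftE-reflects-⟶E k n (arg X) (c-arg r) with cshift-reflects-⟶ k n X r
... | X' , r' , refl = arg X' , c-arg r' , refl
cshiftE-reflects-⟶E k n (case X Y) (c-caseL r) with cshift-reflects-⟶ k n X r
... | X' , r' , refl = case X' Y , c-caseL r' , refl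
cshiftE-reflects-⟶E k n (case X Y) (c-caseR r) with cshift-reflects-⟶ k n Y r
... | Y' , r' , refl = case X Y' , c-caseR r' , refl

wk-reflects-⟶ : ∀ i c X {R} → wk i c X ⟶ R → Σ Tm λ X' → X ⟶ X' × R ≡ wk i c X'
wk-reflects-⟶ i c X r with ishift-reflects-⟶ 0 i (cshift 0 c X) r
... | _ , r₁ , refl with cshift-reflects-⟶ 0 c X r₁
...   | X' , r₂ , refl = X' , r₂ , refl

emb-ishift  : ∀ k n X → emb (ishift k n X) ≡ ishift' k n (emb X)
embE-ishiftE : ∀ k n e → embE (ishiftE k n e) ≡ ishiftE' k n (embE e)
emb-ishift k n (var j)    = refl
emb-ishift k n (lam X)    = cong lam (emb-ishift (suc k) n X)
emb-ishift k n (app X e)  = cong₂ app (emb-ishift k n X) (embE-ishiftE k n e)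
emb-ishift k n (pair X Y) = cong₂ pair (emb-ishift k n X) (emb-ishift k n Y)
emb-ishift k n (ω₁ X)     = cong ω₁ (emb-ishift k n X)
emb-ishift k n (ω₂ X)     = cong ω₂ (emb-ishift k n X)
emb-ishift k n (μ X)      = cong μ (emb-ishift k n X)
emb-ishift k n (nam a X)  = cong (nam a) (emb-ishift k n X)
embE-ishiftE k n (arg X)    = cong arg (emb-ishift k n X)
embE-ishiftE k n π₁         = refl
embE-ishiftE k n π₂         = refl
embE-ishiftE k n (case X Y) = cong₂ case (emb-ishift (suc k) n X) (emb-ishift (suc k) n Y)

emb-cshift  : ∀ k n X → emb (cshift k n X) ≡ cshift' k n (emb X)
embE-cshiftE : ∀ k n e → embE (cshiftE k n e) ≡ cshiftE' k n (embE e)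
emb-cshift k n (var j)    = refl
emb-cshift k n (lam X)    = cong lam (emb-cshift k n X)
emb-cshift k n (app X e)  = cong₂ app (emb-cshift k n X) (embE-cshiftE k n e)
emb-cshift k n (pair X Y) = cong₂ pair (emb-cshift k n X) (emb-cshift k n Y)
emb-cshift k n (ω₁ X)     = cong ω₁ (emb-cshift k n X)
emb-cshift k n (ω₂ X)     = cong ω₂ (emb-cshift k n X)
emb-cshift k n (μ X)      = cong μ (emb-cshift (suc k) n X)
emb-cshift k n (nam a X)  = cong (nam _) (emb-cshift k n X)
embE-cshiftE k n (arg X)    = cong arg (emb-cshift k n X)
embE-cshiftE k n π₁         = refl
embE-cshiftE k n π₂         = refl
embE-cshiftE k n (case X Y) = cong₂ case (emb-cshift k n X) (emb-cshift k n Y)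

emb-substVar : ∀ k P j → emb (substVar k P j) ≡ substVar' k (emb P) j
emb-substVar k P j with j ≡ᵇ k | j <ᵇ k
... | true  | _     = refl
... | false | true  = refl
... | false | false = refl

emb-isub  : ∀ k P X → emb (isub k P X) ≡ isub' k (emb P) (emb X)
embE-isubE : ∀ k P e → embE (isubE k P e) ≡ isubE' k (emb P) (embE e)
emb-isub k P (var j)    = emb-substVar k P j
emb-isub k P (lam X)    rewrite sym (emb-ishift 0 1 P) = cong lam (emb-isub (suc k) (ishift 0 1 P) X)
emb-isub k P (app X e)  = cong₂ app (emb-isub k P X) (embE-isubE k P e)
emb-isub k P (pair X Y) = cong₂ pair (emb-isub k P X) (emb-isub k P Y)
emb-isub k P (ω₁ X)     = cong ω₁ (emb-isub k P X)
emb-isub k P (ω₂ X)     = cong ω₂ (emb-isub k P X)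
emb-isub k P (μ X)      rewrite sym (emb-cshift 0 1 P) = cong μ (emb-isub k (cshift 0 1 P) X)
emb-isub k P (nam a X)  = cong (nam a) (emb-isub k P X)
embE-isubE k P (arg X)    = cong arg (emb-isub k P X)
embE-isubE k P π₁         = refl
embE-isubE k P π₂         = refl
embE-isubE k P (case X Y) rewrite sym (emb-ishift 0 1 P) =
  cong₂ case (emb-isub (suc k) (ishift 0 1 P) X) (emb-isub (suc k) (ishift 0 1 P) Y)

emb-csub  : ∀ k ε X → emb (csub k ε X) ≡ csub' k (embE ε) (emb X)
embE-csubE : ∀ k ε e → embE (csubE k ε e) ≡ csubE' k (embE ε) (embE e)
emb-csub k ε (var j)    = refl
emb-csub k ε (lam X)    rewrite sym (embE-ishiftE 0 1 ε) = cong lam (emb-csub k (ishiftE 0 1 ε) X)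
emb-csub k ε (app X e)  = cong₂ app (emb-csub k ε X) (embE-csubE k ε e)
emb-csub k ε (pair X Y) = cong₂ pair (emb-csub k ε X) (emb-csub k ε Y)
emb-csub k ε (ω₁ X)     = cong ω₁ (emb-csub k ε X)
emb-csub k ε (ω₂ X)     = cong ω₂ (emb-csub k ε X)
emb-csub k ε (μ X)      rewrite sym (embE-cshiftE 0 1 ε) = cong μ (emb-csub (suc k) (cshiftE 0 1 ε) X)
emb-csub k ε (nam a X) with a ≡ᵇ k
... | true  = cong (nam a) (cong₂ app (emb-csub k ε X) refl)
... | false = cong (nam a) (emb-csub k ε X)
embE-csubE k ε (arg X)    = cong arg (emb-csub k ε X)
embE-csubE k ε π₁         = refl
embE-csubE k ε π₂         = refl
embE-csubE k ε (case X Y) rewrite sym (embE-ishiftE 0 1 ε) =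
  cong₂ case (emb-csub k (ishiftE 0 1 ε) X) (emb-csub k (ishiftE 0 1 ε) Y)

emb-⟶  : ∀ {i c X Y} → X ⟶ Y → Red' i c (emb X) (emb Y)
embE-⟶E : ∀ {i c X Y} → X ⟶E Y → RedE' i c (embE X) (embE Y)
emb-⟶ (β {M} {N})           rewrite emb-isub 0 N M = β
emb-⟶ proj₁                  = proj₁
emb-⟶ proj₂                  = proj₂
emb-⟶ (inj₁ {M} {N₁})        rewrite emb-isub 0 M N₁ = inj₁
emb-⟶ (inj₂ {M} {_} {N₂})    rewrite emb-isub 0 M N₂ = inj₂
emb-⟶ (comm {ε = ε})         rewrite embE-ishiftE 0 1 ε = comm
emb-⟶ (μr {M} {ε})           rewrite emb-csub 0 (cshiftE 0 1 ε) M | embE-cshiftE 0 1 ε = μr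
emb-⟶ (c-lam r)   = c-lam (emb-⟶ r)
emb-⟶ (c-appL r)  = c-appL (emb-⟶ r)
emb-⟶ (c-appR r)  = c-appR (embE-⟶E r)
emb-⟶ (c-pairL r) = c-pairL (emb-⟶ r)
emb-⟶ (c-pairR r) = c-pairR (emb-⟶ r)
emb-⟶ (c-ω₁ r)    = c-ω₁ (emb-⟶ r)
emb-⟶ (c-ω₂ r)    = c-ω₂ (emb-⟶ r)
emb-⟶ (c-μ r)     = c-μ (emb-⟶ r)
emb-⟶ (c-nam r)   = c-nam (emb-⟶ r)
embE-⟶E (c-arg r)   = c-arg (emb-⟶ r)
embE-⟶E (c-caseL r) = c-caseL (emb-⟶ r)
embE-⟶E (c-caseR r) = c-caseR (emb-⟶ r)

T₁at-emb  : ∀ i c X → T₁at i c (emb X) ≡ X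
T₁atE-embE : ∀ i c e → T₁atE i c (embE e) ≡ e
T₁at-emb i c (var j)    = refl
T₁at-emb i c (lam X)    = cong lam (T₁at-emb (suc i) c X)
T₁at-emb i c (app X e)  = cong₂ app (T₁at-emb i c X) (T₁atE-embE i c e)
T₁at-emb i c (pair X Y) = cong₂ pair (T₁at-emb i c X) (T₁at-emb i c Y)
T₁at-emb i c (ω₁ X)     = cong ω₁ (T₁at-emb i c X)
T₁at-emb i c (ω₂ X)     = cong ω₂ (T₁at-emb i c X)
T₁at-emb i c (μ X)      = cong μ (T₁at-emb i (suc c) X)
T₁at-emb i c (nam a X)  = cong (nam a) (T₁at-emb i c X)
T₁atE-embE i c (arg X)    = cong arg (T₁at-emb i c X)
T₁atE-embE i c π₁         = refl
T₁atE-embE i c π₂         = refl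
T₁atE-embE i c (case X Y) = cong₂ case (T₁at-emb (suc i) c X) (T₁at-emb (suc i) c Y)

T₁at-ishift'  : ∀ {k i} c n M → k ≤ i → T₁at (i + n) c (ishift' k n M) ≡ ishift k n (T₁at i c M)
T₁atE-ishiftE' : ∀ {k i} c n e → k ≤ i → T₁atE (i + n) c (ishiftE' k n e) ≡ ishiftE k n (T₁atE i c e)
T₁at-ishift' c n (var j)    p = refl
T₁at-ishift' c n (lam M)    p = cong lam (T₁at-ishift' c n M (s≤s p))
T₁at-ishift' c n (app M e)  p = cong₂ app (T₁at-ishift' c n M p) (T₁atE-ishiftE' c n e p)
T₁at-ishift' c n (pair M N) p = cong₂ pair (T₁at-ishift' c n M p) (T₁at-ishift' c n N p)
T₁at-ishift' c n (ω₁ M)     p = cong ω₁ (T₁at-ishift' c n M p)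
T₁at-ishift' c n (ω₂ M)     p = cong ω₂ (T₁at-ishift' c n M p)
T₁at-ishift' c n (μ M)      p = cong μ (T₁at-ishift' (suc c) n M p)
T₁at-ishift' c n (nam a M)  p = cong (nam a) (T₁at-ishift' c n M p)
T₁at-ishift' {i = i} c n (star N) p = sym (ishift-ishift-fuse i n (cshift 0 c N) z≤n p)
T₁atE-ishiftE' c n (arg M)    p = cong arg (T₁at-ishift' c n M p)
T₁atE-ishiftE' c n π₁         p = refl
T₁atE-ishiftE' c n π₂         p = refl
T₁atE-ishiftE' c n (case M N) p = cong₂ case (T₁at-ishift' c n M (s≤s p)) (T₁at-ishift' c n N (s≤s p))
T₁atE-ishiftE' {i = i} c n (box b) p = sym (ishiftE-ishiftE-fuse i n (cshiftE 0 c (boxEl b)) z≤n p)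

T₁atE-ishiftE'₁ : ∀ i c e → T₁atE (suc i) c (ishiftE' 0 1 e) ≡ ishiftE 0 1 (T₁atE i c e)
T₁atE-ishiftE'₁ i c e rewrite sym (+-comm i 1) = T₁atE-ishiftE' c 1 e z≤n

T₁at-ishift'₁ : ∀ i c M → T₁at (suc i) c (ishift' 0 1 M) ≡ ishift 0 1 (T₁at i c M)
T₁at-ishift'₁ i c M rewrite sym (+-comm i 1) = T₁at-ishift' c 1 M z≤n

T₁at-cshift'  : ∀ {k c} i n M → k ≤ c → T₁at i (c + n) (cshift' k n M) ≡ cshift k n (T₁at i c M)
T₁atE-cshiftE' : ∀ {k c} i n e → k ≤ c → T₁atE i (c + n) (cshiftE' k n e) ≡ cshiftE k n (T₁atE i c e)
T₁at-cshift' i n (var j)    p = refl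
T₁at-cshift' i n (lam M)    p = cong lam (T₁at-cshift' (suc i) n M p)
T₁at-cshift' i n (app M e)  p = cong₂ app (T₁at-cshift' i n M p) (T₁atE-cshiftE' i n e p)
T₁at-cshift' i n (pair M N) p = cong₂ pair (T₁at-cshift' i n M p) (T₁at-cshift' i n N p)
T₁at-cshift' i n (ω₁ M)     p = cong ω₁ (T₁at-cshift' i n M p)
T₁at-cshift' i n (ω₂ M)     p = cong ω₂ (T₁at-cshift' i n M p)
T₁at-cshift' i n (μ M)      p = cong μ (T₁at-cshift' i n M (s≤s p))
T₁at-cshift' i n (nam a M)  p = cong (nam _) (T₁at-cshift' i n M p)
T₁at-cshift' {k} {c} i n (star N) p rewrite sym (ishift-cshift-comm 0 i k n (cshift 0 c N)) =
  cong (ishift 0 i) (sym (cshift-cshift-fuse c n N z≤n p))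
T₁atE-cshiftE' i n (arg M)    p = cong arg (T₁at-cshift' i n M p)
T₁atE-cshiftE' i n π₁         p = refl
T₁atE-cshiftE' i n π₂         p = refl
T₁atE-cshiftE' i n (case M N) p = cong₂ case (T₁at-cshift' (suc i) n M p) (T₁at-cshift' (suc i) n N p)
T₁atE-cshiftE' {k} {c} i n (box b) p rewrite sym (ishiftE-cshiftE-comm 0 i k n (cshiftE 0 c (boxEl b))) =
  cong (ishiftE 0 i) (sym (cshiftE-cshiftE-fuse c n (boxEl b) z≤n p))

T₁atE-cshiftE'₁ : ∀ i c e → T₁atE i (suc c) (cshiftE' 0 1 e) ≡ cshiftE 0 1 (T₁atE i c e)
T₁atE-cshiftE'₁ i c e rewrite sym (+-comm c 1) = T₁atE-cshiftE' i 1 e z≤n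

T₁at-cshift'₁ : ∀ i c M → T₁at i (suc c) (cshift' 0 1 M) ≡ cshift 0 1 (T₁at i c M)
T₁at-cshift'₁ i c M rewrite sym (+-comm c 1) = T₁at-cshift' i 1 M z≤n

T₁at-substVar' : ∀ i c k P j → T₁at i c (substVar' k P j) ≡ substVar k (T₁at i c P) j
T₁at-substVar' i c k P j with j ≡ᵇ k | j <ᵇ k
... | true  | _     = refl
... | false | true  = refl
... | false | false = refl

T₁at-isub'  : ∀ k i c P M →
              T₁at (k + i) c (isub' k P M) ≡ isub k (T₁at (k + i) c P) (T₁at (suc (k + i)) c M)
T₁atE-isubE' : ∀ k i c P e →
              T₁atE (k + i) c (isubE' k P e) ≡ isubE k (T₁at (k + i) c P) (T₁atE (suc (k + i)) c e)
T₁at-isub' k i c P (var j)    = T₁at-substVar' (k + i) c k P j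
T₁at-isub' k i c P (lam M)    rewrite sym (T₁at-ishift'₁ (k + i) c P) =
  cong lam (T₁at-isub' (suc k) i c (ishift' 0 1 P) M)
T₁at-isub' k i c P (app M e)  = cong₂ app (T₁at-isub' k i c P M) (T₁atE-isubE' k i c P e)
T₁at-isub' k i c P (pair M N) = cong₂ pair (T₁at-isub' k i c P M) (T₁at-isub' k i c P N)
T₁at-isub' k i c P (ω₁ M)     = cong ω₁ (T₁at-isub' k i c P M)
T₁at-isub' k i c P (ω₂ M)     = cong ω₂ (T₁at-isub' k i c P M)
T₁at-isub' k i c P (μ M)      rewrite sym (T₁at-cshift'₁ (k + i) c P) =
  cong μ (T₁at-isub' k i (suc c) (cshift' 0 1 P) M)
T₁at-isub' k i c P (nam a M)  = cong (nam a) (T₁at-isub' k i c P M)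
T₁at-isub' k i c P (star N)   = sym (isub-ishift (k + i) _ (cshift 0 c N) z≤n (m≤m+n k i))
T₁atE-isubE' k i c P (arg M)    = cong arg (T₁at-isub' k i c P M)
T₁atE-isubE' k i c P π₁         = refl
T₁atE-isubE' k i c P π₂         = refl
T₁atE-isubE' k i c P (case M N) rewrite sym (T₁at-ishift'₁ (k + i) c P) =
  cong₂ case (T₁at-isub' (suc k) i c (ishift' 0 1 P) M) (T₁at-isub' (suc k) i c (ishift' 0 1 P) N)
T₁atE-isubE' k i c P (box b)    = sym (isubE-ishiftE (k + i) _ (cshiftE 0 c (boxEl b)) z≤n (m≤m+n k i))

T₁at-csub'  : ∀ {k d} i ε M → k < d → T₁at i d (csub' k ε M) ≡ csub k (T₁atE i d ε) (T₁at i d M)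
T₁atE-csubE' : ∀ {k d} i ε e → k < d → T₁atE i d (csubE' k ε e) ≡ csubE k (T₁atE i d ε) (T₁atE i d e)
T₁at-csub' i ε (var j)    p = refl
T₁at-csub' {d = d} i ε (lam M) p rewrite sym (T₁atE-ishiftE'₁ i d ε) =
  cong lam (T₁at-csub' (suc i) (ishiftE' 0 1 ε) M p)
T₁at-csub' i ε (app M e)  p = cong₂ app (T₁at-csub' i ε M p) (T₁atE-csubE' i ε e p)
T₁at-csub' i ε (pair M N) p = cong₂ pair (T₁at-csub' i ε M p) (T₁at-csub' i ε N p)
T₁at-csub' i ε (ω₁ M)     p = cong ω₁ (T₁at-csub' i ε M p)
T₁at-csub' i ε (ω₂ M)     p = cong ω₂ (T₁at-csub' i ε M p)
T₁at-csub' {d = d} i ε (μ M) p rewrite sym (T₁atE-cshiftE'₁ i d ε) =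
  cong μ (T₁at-csub' i (cshiftE' 0 1 ε) M (s≤s p))
T₁at-csub' {k} i ε (nam a M) p with a ≡ᵇ k
... | true  = cong (nam a) (cong₂ app (T₁at-csub' i ε M p) refl)
... | false = cong (nam a) (T₁at-csub' i ε M p)
T₁at-csub' {d = d} i ε (star N) p = sym (csub-ishift-cshift d 0 i _ N z≤n p)
T₁atE-csubE' i ε (arg M)    p = cong arg (T₁at-csub' i ε M p)
T₁atE-csubE' i ε π₁         p = refl
T₁atE-csubE' i ε π₂         p = refl
T₁atE-csubE' {d = d} i ε (case M N) p rewrite sym (T₁atE-ishiftE'₁ i d ε) =
  cong₂ case (T₁at-csub' (suc i) (ishiftE' 0 1 ε) M p) (T₁at-csub' (suc i) (ishiftE' 0 1 ε) N p)
T₁atE-csubE' {d = d} i ε (box b) p = sym (csubE-ishiftE-cshiftE d 0 i _ (boxEl b) z≤n p)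

-- A syntax-directed form of correctness

Modes : Set
Modes = ℕ → Bool

infixr 5 _∷ᵐ_
_∷ᵐ_ : Bool → Modes → Modes
(s ∷ᵐ K) zero    = s
(s ∷ᵐ K) (suc a) = K a

-- In Wf K s M the mode s is true when M has to lie in st(U) for an enclosing (U [ε]), and K a is
-- the mode of the arguments of the classical variable a. Applying e to a term of mode s gives a term
-- of mode s' when Elim K s s' e.
data Wf   : Modes → Bool → Tm' → Set
data Elim : Modes → Bool → Bool → El' → Set

data Wf where
  var  : ∀ {K j} → Wf K false (var j)
  lam  : ∀ {K M} → Wf K false M → Wf K false (lam M)
  app  : ∀ {K s s' M e} → Wf K s M → Elim K s s' e → Wf K s' (app M e)
  pair : ∀ {K M N} → Wf K false M → Wf K false N → Wf K false (pair M N)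
  ω₁   : ∀ {K M} → Wf K false M → Wf K false (ω₁ M)
  ω₂   : ∀ {K M} → Wf K false M → Wf K false (ω₂ M)
  μ    : ∀ {K s M} → Wf (s ∷ᵐ K) false M → Wf K s (μ M)
  nam  : ∀ {K s a M} → K a ≡ s → Wf K s M → Wf K false (nam a M)
  star : ∀ {K N} → Wf K true (star N)

data Elim where
  arg  : ∀ {K M} → Wf K false M → Elim K false false (arg M)
  π₁   : ∀ {K} → Elim K false false π₁
  π₂   : ∀ {K} → Elim K false false π₂
  case : ∀ {K s M N} → Wf K s M → Wf K s N → Elim K false s (case M N)
  box  : ∀ {K b} → Elim K true false (box b)

Wf-ishift'  : ∀ {K s} k n {M} → Wf K s M → Wf K s (ishift' k n M)
Elim-ishiftE' : ∀ {K s s'} k n {e} → Elim K s s' e → Elim K s s' (ishiftE' k n e)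
Wf-ishift' k n var         = var
Wf-ishift' k n (lam d)     = lam (Wf-ishift' (suc k) n d)
Wf-ishift' k n (app d el)  = app (Wf-ishift' k n d) (Elim-ishiftE' k n el)
Wf-ishift' k n (pair d d') = pair (Wf-ishift' k n d) (Wf-ishift' k n d')
Wf-ishift' k n (ω₁ d)      = ω₁ (Wf-ishift' k n d)
Wf-ishift' k n (ω₂ d)      = ω₂ (Wf-ishift' k n d)
Wf-ishift' k n (μ d)       = μ (Wf-ishift' k n d)
Wf-ishift' k n (nam eq d)  = nam eq (Wf-ishift' k n d)
Wf-ishift' k n star        = star
Elim-ishiftE' k n (arg d)     = arg (Wf-ishift' k n d)
Elim-ishiftE' k n π₁          = π₁
Elim-ishiftE' k n π₂          = π₂
Elim-ishiftE' k n (case d d') = case (Wf-ishift' (suc k) n d) (Wf-ishift' (suc k) n d')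
Elim-ishiftE' k n box         = box

Renames : Modes → Modes → ℕ → ℕ → Set
Renames K K' k n = ∀ a → K' (shiftVar k n a) ≡ K a

Renames-∷ : ∀ s {K K' k n} → Renames K K' k n → Renames (s ∷ᵐ K) (s ∷ᵐ K') (suc k) n
Renames-∷ s r zero    = refl
Renames-∷ s {K' = K'} {k} {n} r (suc a) = trans (cong (s ∷ᵐ K') (shiftVar-suc k n a)) (r a)

Renames-weaken : ∀ s K → Renames K (s ∷ᵐ K) 0 1
Renames-weaken s K a = cong (s ∷ᵐ K) (trans (shiftVar-≥ {0} {1} {a} z≤n) (+-comm a 1))

Wf-cshift'  : ∀ {K K' s} k n {M} → Renames K K' k n → Wf K s M → Wf K' s (cshift' k n M)
Elim-cshiftE' : ∀ {K K' s s'} k n {e} → Renames K K' k n → Elim K s s' e → Elim K' s s' (cshiftE' k n e)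
Wf-cshift' k n r var         = var
Wf-cshift' k n r (lam d)     = lam (Wf-cshift' k n r d)
Wf-cshift' k n r (app d el)  = app (Wf-cshift' k n r d) (Elim-cshiftE' k n r el)
Wf-cshift' k n r (pair d d') = pair (Wf-cshift' k n r d) (Wf-cshift' k n r d')
Wf-cshift' k n r (ω₁ d)      = ω₁ (Wf-cshift' k n r d)
Wf-cshift' k n r (ω₂ d)      = ω₂ (Wf-cshift' k n r d)
Wf-cshift' k n r (μ {s = s} d) = μ (Wf-cshift' (suc k) n (Renames-∷ s r) d)
Wf-cshift' k n r (nam {a = a} eq d) = nam (trans (r a) eq) (Wf-cshift' k n r d)
Wf-cshift' k n r star        = star
Elim-cshiftE' k n r (arg d)     = arg (Wf-cshift' k n r d)
Elim-cshiftE' k n r π₁          = π₁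
Elim-cshiftE' k n r π₂          = π₂
Elim-cshiftE' k n r (case d d') = case (Wf-cshift' k n r d) (Wf-cshift' k n r d')
Elim-cshiftE' k n r box         = box

Wf-substVar' : ∀ {K} k {P} j → Wf K false P → Wf K false (substVar' k P j)
Wf-substVar' k j d with j ≡ᵇ k | j <ᵇ k
... | true  | _     = d
... | false | true  = var
... | false | false = var

Wf-isub'  : ∀ {K s} k {P M} → Wf K false P → Wf K s M → Wf K s (isub' k P M)
Elim-isubE' : ∀ {K s s'} k {P e} → Wf K false P → Elim K s s' e → Elim K s s' (isubE' k P e)
Wf-isub' k dP (var {j = j}) = Wf-substVar' k j dP
Wf-isub' k dP (lam d)       = lam (Wf-isub' (suc k) (Wf-ishift' 0 1 dP) d)
Wf-isub' k dP (app d el)    = app (Wf-isub' k dP d) (Elim-isubE' k dP el)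
Wf-isub' k dP (pair d d')   = pair (Wf-isub' k dP d) (Wf-isub' k dP d')
Wf-isub' k dP (ω₁ d)        = ω₁ (Wf-isub' k dP d)
Wf-isub' k dP (ω₂ d)        = ω₂ (Wf-isub' k dP d)
Wf-isub' {K} k dP (μ {s = s} d) = μ (Wf-isub' k (Wf-cshift' 0 1 (Renames-weaken s K) dP) d)
Wf-isub' k dP (nam eq d)    = nam eq (Wf-isub' k dP d)
Wf-isub' k dP star          = star
Elim-isubE' k dP (arg d)     = arg (Wf-isub' k dP d)
Elim-isubE' k dP π₁          = π₁
Elim-isubE' k dP π₂          = π₂
Elim-isubE' k dP (case d d') = case (Wf-isub' (suc k) (Wf-ishift' 0 1 dP) d) (Wf-isub' (suc k) (Wf-ishift' 0 1 dP) d')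
Elim-isubE' k dP box         = box

Wf-csub'  : ∀ {K K' s} k {ε M} → (∀ a → a ≢ k → K' a ≡ K a) → Elim K' (K k) (K' k) ε →
            Wf K s M → Wf K' s (csub' k ε M)
Elim-csubE' : ∀ {K K' s s'} k {ε e} → (∀ a → a ≢ k → K' a ≡ K a) → Elim K' (K k) (K' k) ε →
            Elim K s s' e → Elim K' s s' (csubE' k ε e)
Wf-csub' k ag dε var         = var
Wf-csub' k ag dε (lam d)     = lam (Wf-csub' k ag (Elim-ishiftE' 0 1 dε) d)
Wf-csub' k ag dε (app d el)  = app (Wf-csub' k ag dε d) (Elim-csubE' k ag dε el)
Wf-csub' k ag dε (pair d d') = pair (Wf-csub' k ag dε d) (Wf-csub' k ag dε d')
Wf-csub' k ag dε (ω₁ d)      = ω₁ (Wf-csub' k ag dε d)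
Wf-csub' k ag dε (ω₂ d)      = ω₂ (Wf-csub' k ag dε d)
Wf-csub' {K' = K'} k ag dε (μ {s = s} d) =
  μ (Wf-csub' (suc k) ag-∷ (Elim-cshiftE' 0 1 (Renames-weaken s K') dε) d)
  where
  ag-∷ : ∀ a → a ≢ suc k → (s ∷ᵐ K') a ≡ (s ∷ᵐ _) a
  ag-∷ zero    _  = refl
  ag-∷ (suc a) a≢ = ag a (λ a≡k → a≢ (cong suc a≡k))
Wf-csub' k ag dε (nam {a = a} refl d) with a ≡ᵇ k | ≡ᵇ-reflects-≡ a k
... | true  | ofʸ refl = nam refl (app (Wf-csub' k ag dε d) dε)
... | false | ofⁿ a≢k = nam (ag a a≢k) (Wf-csub' k ag dε d)
Wf-csub' k ag dε star        = star
Elim-csubE' k ag dε (arg d)     = arg (Wf-csub' k ag dε d)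
Elim-csubE' k ag dε π₁          = π₁
Elim-csubE' k ag dε π₂          = π₂
Elim-csubE' k ag dε (case d d') =
  case (Wf-csub' k ag (Elim-ishiftE' 0 1 dε) d) (Wf-csub' k ag (Elim-ishiftE' 0 1 dε) d')
Elim-csubE' k ag dε box         = box

AllPlain : Modes → Set
AllPlain K = ∀ a → K a ≡ false

Wf-emb  : ∀ {K} → AllPlain K → ∀ X → Wf K false (emb X)
Elim-embE : ∀ {K} → AllPlain K → ∀ e → Elim K false false (embE e)
Wf-emb p (var j)    = var
Wf-emb p (lam X)    = lam (Wf-emb p X)
Wf-emb p (app X e)  = app (Wf-emb p X) (Elim-embE p e)
Wf-emb p (pair X Y) = pair (Wf-emb p X) (Wf-emb p Y)
Wf-emb p (ω₁ X)     = ω₁ (Wf-emb p X)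
Wf-emb p (ω₂ X)     = ω₂ (Wf-emb p X)
Wf-emb p (μ X)      = μ (Wf-emb (λ { zero → refl ; (suc a) → p a }) X)
Wf-emb p (nam a X)  = nam (p a) (Wf-emb p X)
Elim-embE p (arg X)    = arg (Wf-emb p X)
Elim-embE p π₁         = π₁
Elim-embE p π₂         = π₂
Elim-embE p (case X Y) = case (Wf-emb p X) (Wf-emb p Y)

-- The contents of N⋆ and [ε] only refer to the top-level context, whose classical variables are
-- a + c at binder depth c.
GlobalsPlain : Modes → ℕ → Set
GlobalsPlain K c = ∀ a → K (a + c) ≡ false

GlobalsPlain-∷ : ∀ s {K c} → GlobalsPlain K c → GlobalsPlain (s ∷ᵐ K) (suc c)
GlobalsPlain-∷ s {K} {c} g a = trans (cong (s ∷ᵐ K) (+-suc a c)) (g a)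

Renames-globals : ∀ {K c} → GlobalsPlain K c → Renames (λ _ → false) K 0 c
Renames-globals {K} {c} g a = trans (cong K (shiftVar-≥ {0} {c} {a} z≤n)) (g a)

Wf-emb-wk : ∀ {K c} i → GlobalsPlain K c → ∀ N → Wf K false (emb (wk i c N))
Wf-emb-wk {K} {c} i g N rewrite emb-ishift 0 i (cshift 0 c N) | emb-cshift 0 c N =
  Wf-ishift' 0 i (Wf-cshift' 0 c (Renames-globals {K} {c} g) (Wf-emb (λ _ → refl) N))

Elim-embE-wkE : ∀ {K c} i → GlobalsPlain K c → ∀ e → Elim K false false (embE (wkE i c e))
Elim-embE-wkE {K} {c} i g e rewrite embE-ishiftE 0 i (cshiftE 0 c e) | embE-cshiftE 0 c e =
  Elim-ishiftE' 0 i (Elim-cshiftE' 0 c (Renames-globals {K} {c} g) (Elim-embE (λ _ → refl) e))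

Wf-Red'  : ∀ {i c K s M M'} → GlobalsPlain K c → Red' i c M M' → Wf K s M → Wf K s M'
Elim-RedE' : ∀ {i c K s s' e e'} → GlobalsPlain K c → RedE' i c e e' → Elim K s s' e → Elim K s s' e'
Wf-Red' g β      (app (lam d) (arg dN))            = Wf-isub' 0 dN d
Wf-Red' g proj₁  (app (pair d _) π₁)                = d
Wf-Red' g proj₂  (app (pair _ d) π₂)                = d
Wf-Red' g inj₁   (app (ω₁ dR) (case d _))          = Wf-isub' 0 dR d
Wf-Red' g inj₂   (app (ω₂ dR) (case _ d))          = Wf-isub' 0 dR d
Wf-Red' g comm   (app (app d (case d₁ d₂)) el)     =
  app d (case (app d₁ (Elim-ishiftE' 0 1 el)) (app d₂ (Elim-ishiftE' 0 1 el)))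
Wf-Red' {K = K} g μr (app (μ d) el) =
  μ (Wf-csub' 0 (λ { zero 0≢0 → contradiction refl 0≢0 ; (suc a) _ → refl })
              (Elim-cshiftE' 0 1 (Renames-weaken _ K) el) d)
Wf-Red' g (unmark {i} {b = b}) (app star box) = app (Wf-emb-wk i g _) (Elim-embE-wkE i g (boxEl b))
Wf-Red' g (c-star r)  star        = star
Wf-Red' g (c-lam r)   (lam d)     = lam (Wf-Red' g r d)
Wf-Red' g (c-appL r)  (app d el)  = app (Wf-Red' g r d) el
Wf-Red' g (c-appR r)  (app d el)  = app d (Elim-RedE' g r el)
Wf-Red' g (c-pairL r) (pair d d') = pair (Wf-Red' g r d) d'
Wf-Red' g (c-pairR r) (pair d d') = pair d (Wf-Red' g r d')
Wf-Red' g (c-ω₁ r)    (ω₁ d)      = ω₁ (Wf-Red' g r d)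
Wf-Red' g (c-ω₂ r)    (ω₂ d)      = ω₂ (Wf-Red' g r d)
Wf-Red' g (c-μ r)     (μ {s = s} d) = μ (Wf-Red' (GlobalsPlain-∷ s g) r d)
Wf-Red' g (c-nam r)   (nam eq d)  = nam eq (Wf-Red' g r d)
Elim-RedE' g (c-arg r)   (arg d)     = arg (Wf-Red' g r d)
Elim-RedE' g (c-caseL r) (case d d') = case (Wf-Red' g r d) d'
Elim-RedE' g (c-caseR r) (case d d') = case d (Wf-Red' g r d')
Elim-RedE' g (c-box r)   box         = box

Wf-Red'⁺ : ∀ {i c K s M M'} → GlobalsPlain K c → TransClosure (Red' i c) M M' → Wf K s M → Wf K s M'
Wf-Red'⁺ g [ r ]    d = Wf-Red' g r d
Wf-Red'⁺ g (r ∷ rs) d = Wf-Red'⁺ g rs (Wf-Red' g r d)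

-- Simulation of unmarked steps

map⁺ : ∀ {A B : Set} {R : A → A → Set} {S : B → B → Set} (f : A → B) →
       (∀ {x y} → R x y → S (f x) (f y)) → ∀ {x y} → TransClosure R x y → TransClosure S (f x) (f y)
map⁺ f g [ r ]    = [ g r ]
map⁺ f g (r ∷ rs) = g r ∷ map⁺ f g rs

Simulated : ℕ → ℕ → Tm' → Tm → Set
Simulated i c M N = Σ Tm' λ M' → TransClosure (Red' i c) M M' × T₁at i c M' ≡ N

SimulatedE : ℕ → ℕ → El' → El → Set
SimulatedE i c e N = Σ El' λ e' → TransClosure (RedE' i c) e e' × T₁atE i c e' ≡ N

Simulated-appL : ∀ {i c M N} e → Simulated i c M N → Simulated i c (app M e) (app N (T₁atE i c e))
Simulated-appL e (M' , rs , eq) = app M' e , map⁺ (λ x → app x e) c-appL rs , cong (λ x → app x _) eq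

Simulated-appR : ∀ {i c e N} M → SimulatedE i c e N → Simulated i c (app M e) (app (T₁at i c M) N)
Simulated-appR M (e' , rs , eq) = app M e' , map⁺ (app M) c-appR rs , cong (app _) eq

simulate  : ∀ {i c K s M N} → Wf K s M → T₁at i c M ⟶ N → Simulated i c M N
simulateE : ∀ {i c K s s' e N} → Elim K s s' e → T₁atE i c e ⟶E N → SimulatedE i c e N
simulate {i} {c} (app star box) r = _ , unmark ∷ [ emb-⟶ r ] , T₁at-emb i c _
simulate {i} {c} (app {M = lam P} _ (arg {M = Q} _)) β = _ , [ β ] , T₁at-isub' 0 i c Q P
simulate (app (pair _ _) π₁) proj₁ = _ , [ proj₁ ] , refl
simulate (app (pair _ _) π₂) proj₂ = _ , [ proj₂ ] , refl
simulate {i} {c} (app {M = ω₁ R} _ (case {M = N₁} _ _)) inj₁ = _ , [ inj₁ ] , T₁at-isub' 0 i c R N₁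
simulate {i} {c} (app {M = ω₂ R} _ (case {N = N₂} _ _)) inj₂ = _ , [ inj₂ ] , T₁at-isub' 0 i c R N₂
simulate {i} {c} (app {e = ε} (app _ (case _ _)) _) comm =
  _ , [ comm ] , cong (λ ε' → app _ (case (app _ ε') (app _ ε'))) (T₁atE-ishiftE'₁ i c ε)
simulate {i} {c} (app {M = μ M} {e = ε} _ _) μr =
  _ , [ μr ] , cong μ (trans (T₁at-csub' i (cshiftE' 0 1 ε) M (s≤s z≤n))
                             (cong (λ ε' → csub 0 ε' (T₁at i (suc c) M)) (T₁atE-cshiftE'₁ i c ε)))
-- Splitting the inner box lets T₁ compute its contents, which rules out a comm redex.
simulate (app d@(app _ (box {b = bt _})) _) (c-appL r) = Simulated-appL _ (simulate d r)
simulate (app d@(app _ (box {b = bπ₁})) _) (c-appL r) = Simulated-appL _ (simulate d r)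
simulate (app d@(app _ (box {b = bπ₂})) _) (c-appL r) = Simulated-appL _ (simulate d r)
simulate (app d _)  (c-appL r) = Simulated-appL _ (simulate d r)
simulate (app _ el) (c-appR r) = Simulated-appR _ (simulateE el r)
simulate (lam d) (c-lam r) with simulate d r
... | M' , rs , eq = lam M' , map⁺ lam c-lam rs , cong lam eq
simulate (pair d _) (c-pairL r) with simulate d r
... | M' , rs , eq = pair M' _ , map⁺ (λ x → pair x _) c-pairL rs , cong (λ x → pair x _) eq
simulate (pair _ d) (c-pairR r) with simulate d r
... | M' , rs , eq = pair _ M' , map⁺ (pair _) c-pairR rs , cong (pair _) eq
simulate (ω₁ d) (c-ω₁ r) with simulate d r
... | M' , rs , eq = ω₁ M' , map⁺ ω₁ c-ω₁ rs , cong ω₁ eq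
simulate (ω₂ d) (c-ω₂ r) with simulate d r
... | M' , rs , eq = ω₂ M' , map⁺ ω₂ c-ω₂ rs , cong ω₂ eq
simulate (μ d) (c-μ r) with simulate d r
... | M' , rs , eq = μ M' , map⁺ μ c-μ rs , cong μ eq
simulate (nam {a = a} _ d) (c-nam r) with simulate d r
... | M' , rs , eq = nam a M' , map⁺ (nam a) c-nam rs , cong (nam a) eq
simulate {i} {c} (star {N = N}) r with wk-reflects-⟶ i c N r
... | N' , r' , eq = star N' , [ c-star r' ] , sym eq
simulateE (arg d) (c-arg r) with simulate d r
... | M' , rs , eq = arg M' , map⁺ arg c-arg rs , cong arg eq
simulateE (case d _) (c-caseL r) with simulate d r
... | M' , rs , eq = case M' _ , map⁺ (λ x → case x _) c-caseL rs , cong (λ x → case x _) eq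
simulateE (case _ d) (c-caseR r) with simulate d r
... | M' , rs , eq = case _ M' , map⁺ (case _) c-caseR rs , cong (case _) eq
simulateE {i} {c} (box {b = bt Q}) (c-arg r) with wk-reflects-⟶ i c Q r
... | Q' , r' , eq = box (bt Q') , [ c-box (c-bt r') ] , cong arg (sym eq)

-- Correctness agrees with Wf at the top level

∈-map-∷⁻ : ∀ {d : Dir} {p xs} → d ∷ p ∈ map (d ∷_) xs → p ∈ xs
∈-map-∷⁻ m with map∷⁻ m
... | _ , p∈ , refl = p∈

∈-++-map-∷ˡ⁻ : ∀ {d d' : Dir} {p} xs {ys} → d ≢ d' →
               d ∷ p ∈ map (d ∷_) xs ++ map (d' ∷_) ys → p ∈ xs
∈-++-map-∷ˡ⁻ xs d≢d' m with ∈-++⁻ (map _ xs) m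
... | inj₁ m' = ∈-map-∷⁻ m'
... | inj₂ m' with map∷⁻ m'
...   | _ , _ , refl = contradiction refl d≢d'

∈-++-map-∷ʳ⁻ : ∀ {d d' : Dir} {p} xs {ys} → d' ≢ d →
               d' ∷ p ∈ map (d ∷_) xs ++ map (d' ∷_) ys → p ∈ ys
∈-++-map-∷ʳ⁻ xs d'≢d m with ∈-++⁻ (map _ xs) m
... | inj₂ m' = ∈-map-∷⁻ m'
... | inj₁ m' with map∷⁻ m'
...   | _ , _ , refl = contradiction refl d'≢d

stPos⊆stNamed-nam : ∀ a {M p} → p ∈ stPos M → namD ∷ p ∈ stNamed a (nam a M)
stPos⊆stNamed-nam a m with a ≡ᵇ a | ≡ᵇ-reflects-≡ a a
... | true  | _       = ∈-++⁺ˡ (∈-map⁺ _ m)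
... | false | ofⁿ a≢a = contradiction refl a≢a

data Occ : Tm' → Pos → Tm' → Set where
  here     : ∀ {M} → Occ M [] M
  in-lam   : ∀ {M p X} → Occ M p X → Occ (lam M) (lamD ∷ p) X
  in-appF  : ∀ {M e p X} → Occ M p X → Occ (app M e) (appF ∷ p) X
  in-arg   : ∀ {N M p X} → Occ M p X → Occ (app N (arg M)) (appA ∷ argD ∷ p) X
  in-caseL : ∀ {N M M₂ p X} → Occ M p X → Occ (app N (case M M₂)) (appA ∷ caseL ∷ p) X
  in-caseR : ∀ {N M₁ M p X} → Occ M p X → Occ (app N (case M₁ M)) (appA ∷ caseR ∷ p) X
  in-pairL : ∀ {M N p X} → Occ M p X → Occ (pair M N) (pairL ∷ p) X
  in-pairR : ∀ {M N p X} → Occ N p X → Occ (pair M N) (pairR ∷ p) X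
  in-ω₁    : ∀ {M p X} → Occ M p X → Occ (ω₁ M) (ω₁D ∷ p) X
  in-ω₂    : ∀ {M p X} → Occ M p X → Occ (ω₂ M) (ω₂D ∷ p) X
  in-μ     : ∀ {M p X} → Occ M p X → Occ (μ M) (μD ∷ p) X
  in-nam   : ∀ {a M p X} → Occ M p X → Occ (nam a M) (namD ∷ p) X

Occ⇒atT : ∀ {M p X} → Occ M p X → atT M p ≡ just X
Occ⇒atT here         = refl
Occ⇒atT (in-lam o)   = Occ⇒atT o
Occ⇒atT (in-appF o)  = Occ⇒atT o
Occ⇒atT (in-arg o)   = Occ⇒atT o
Occ⇒atT (in-caseL o) = Occ⇒atT o
Occ⇒atT (in-caseR o) = Occ⇒atT o
Occ⇒atT (in-pairL o) = Occ⇒atT o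
Occ⇒atT (in-pairR o) = Occ⇒atT o
Occ⇒atT (in-ω₁ o)    = Occ⇒atT o
Occ⇒atT (in-ω₂ o)    = Occ⇒atT o
Occ⇒atT (in-μ o)     = Occ⇒atT o
Occ⇒atT (in-nam o)   = Occ⇒atT o

-- In every omitted case atT returns nothing, so Agda refutes the equation.
atT⇒Occ : ∀ M p {X} → atT M p ≡ just X → Occ M p X
atT⇒Occ M [] refl = here
atT⇒Occ (lam M) (lamD ∷ p) eq = in-lam (atT⇒Occ M p eq)
atT⇒Occ (app M _) (appF ∷ p) eq = in-appF (atT⇒Occ M p eq)
atT⇒Occ (app _ (arg M)) (appA ∷ argD ∷ p) eq = in-arg (atT⇒Occ M p eq)
atT⇒Occ (app _ (case M _)) (appA ∷ caseL ∷ p) eq = in-caseL (atT⇒Occ M p eq)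
atT⇒Occ (app _ (case _ M)) (appA ∷ caseR ∷ p) eq = in-caseR (atT⇒Occ M p eq)
atT⇒Occ (pair M _) (pairL ∷ p) eq = in-pairL (atT⇒Occ M p eq)
atT⇒Occ (pair _ N) (pairR ∷ p) eq = in-pairR (atT⇒Occ N p eq)
atT⇒Occ (ω₁ M) (ω₁D ∷ p) eq = in-ω₁ (atT⇒Occ M p eq)
atT⇒Occ (ω₂ M) (ω₂D ∷ p) eq = in-ω₂ (atT⇒Occ M p eq)
atT⇒Occ (μ M) (μD ∷ p) eq = in-μ (atT⇒Occ M p eq)
atT⇒Occ (nam a M) (namD ∷ p) eq = in-nam (atT⇒Occ M p eq)

Wf⇒Acceptable : ∀ {K M} → Wf K true M → Acceptable M
Wf⇒namedArgs-Acceptable : ∀ {K s M} k → Wf K s M → K k ≡ true → All Acceptable (namedArgs k M)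
Elim⇒namedArgsE-Acceptable : ∀ {K s s' e} k → Elim K s s' e → K k ≡ true → All Acceptable (namedArgsE k e)
Wf⇒Acceptable star                 = acc⋆
Wf⇒Acceptable (μ d)                = accμ (Wf⇒namedArgs-Acceptable 0 d refl)
Wf⇒Acceptable (app _ (case d₁ d₂)) = acc[] (Wf⇒Acceptable d₁) (Wf⇒Acceptable d₂)
Wf⇒namedArgs-Acceptable k var         h = []
Wf⇒namedArgs-Acceptable k (lam d)     h = Wf⇒namedArgs-Acceptable k d h
Wf⇒namedArgs-Acceptable k (app d el)  h =
  All.++⁺ (Wf⇒namedArgs-Acceptable k d h) (Elim⇒namedArgsE-Acceptable k el h)
Wf⇒namedArgs-Acceptable k (pair d d') h =
  All.++⁺ (Wf⇒namedArgs-Acceptable k d h) (Wf⇒namedArgs-Acceptable k d' h)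
Wf⇒namedArgs-Acceptable k (ω₁ d)      h = Wf⇒namedArgs-Acceptable k d h
Wf⇒namedArgs-Acceptable k (ω₂ d)      h = Wf⇒namedArgs-Acceptable k d h
Wf⇒namedArgs-Acceptable k (μ d)       h = Wf⇒namedArgs-Acceptable (suc k) d h
Wf⇒namedArgs-Acceptable {K} k (nam {a = a} {M = M} refl d) h with a ≡ᵇ k | ≡ᵇ-reflects-≡ a k
... | true  | ofʸ refl = Wf⇒Acceptable (subst (λ s → Wf K s M) h d) ∷ Wf⇒namedArgs-Acceptable k d h
... | false | _        = Wf⇒namedArgs-Acceptable k d h
Wf⇒namedArgs-Acceptable k star        h = []
Elim⇒namedArgsE-Acceptable k (arg d)     h = Wf⇒namedArgs-Acceptable k d h
Elim⇒namedArgsE-Acceptable k π₁          h = []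
Elim⇒namedArgsE-Acceptable k π₂          h = []
Elim⇒namedArgsE-Acceptable k (case d d') h =
  All.++⁺ (Wf⇒namedArgs-Acceptable k d h) (Wf⇒namedArgs-Acceptable k d' h)
Elim⇒namedArgsE-Acceptable k box         h = []

Wf⇒boxed-Acceptable : ∀ {K s M q U b} → Wf K s M → Occ M q (app U (box b)) → Acceptable U
Wf⇒boxed-Acceptable (app d box)          here         = Wf⇒Acceptable d
Wf⇒boxed-Acceptable (lam d)              (in-lam o)   = Wf⇒boxed-Acceptable d o
Wf⇒boxed-Acceptable (app d _)            (in-appF o)  = Wf⇒boxed-Acceptable d o
Wf⇒boxed-Acceptable (app _ (arg d))      (in-arg o)   = Wf⇒boxed-Acceptable d o
Wf⇒boxed-Acceptable (app _ (case d _))   (in-caseL o) = Wf⇒boxed-Acceptable d o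
Wf⇒boxed-Acceptable (app _ (case _ d))   (in-caseR o) = Wf⇒boxed-Acceptable d o
Wf⇒boxed-Acceptable (pair d _)           (in-pairL o) = Wf⇒boxed-Acceptable d o
Wf⇒boxed-Acceptable (pair _ d)           (in-pairR o) = Wf⇒boxed-Acceptable d o
Wf⇒boxed-Acceptable (ω₁ d)               (in-ω₁ o)    = Wf⇒boxed-Acceptable d o
Wf⇒boxed-Acceptable (ω₂ d)               (in-ω₂ o)    = Wf⇒boxed-Acceptable d o
Wf⇒boxed-Acceptable (μ d)                (in-μ o)     = Wf⇒boxed-Acceptable d o
Wf⇒boxed-Acceptable (nam _ d)            (in-nam o)   = Wf⇒boxed-Acceptable d o

-- The ways in which an occurrence at p can meet condition (2) of correctness inside M, given the
-- modes s and K of the context of M.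
data Licensed : Bool → Modes → Tm' → Pos → Set where
  st    : ∀ {K M p} → p ∈ stPos M → Licensed true K M p
  named : ∀ {s K M p} k → K k ≡ true → p ∈ stNamed k M → Licensed s K M p
  boxed : ∀ {s K M p q U b r} → Occ M q (app U (box b)) → r ∈ stPos U → p ≡ q ++ appF ∷ r →
          Licensed s K M p

Licensed-lam⁺ : ∀ {K M p} → Licensed false K M p → Licensed false K (lam M) (lamD ∷ p)
Licensed-lam⁺ (named k h m)    = named k h (∈-map⁺ _ m)
Licensed-lam⁺ (boxed o m refl) = boxed (in-lam o) m refl

Licensed-appF⁺ : ∀ {K s s' M e p} → Elim K s s' e → Licensed s K M p → Licensed s' K (app M e) (appF ∷ p)
Licensed-appF⁺ box (st m)           = boxed here m refl
Licensed-appF⁺ _   (named k h m)    = named k h (∈-++⁺ˡ (∈-map⁺ _ m))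
Licensed-appF⁺ _   (boxed o m refl) = boxed (in-appF o) m refl

Licensed-arg⁺ : ∀ {K M Q p} → Licensed false K Q p → Licensed false K (app M (arg Q)) (appA ∷ argD ∷ p)
Licensed-arg⁺ {M = M} (named k h m) = named k h (∈-++⁺ʳ (map _ (stNamed k M)) (∈-map⁺ _ (∈-map⁺ _ m)))
Licensed-arg⁺ (boxed o m refl) = boxed (in-arg o) m refl

Licensed-caseL⁺ : ∀ {K s M N₁ N₂ p} → Licensed s K N₁ p →
                  Licensed s K (app M (case N₁ N₂)) (appA ∷ caseL ∷ p)
Licensed-caseL⁺ (st m) = st (∈-++⁺ˡ (∈-map⁺ _ m))
Licensed-caseL⁺ {M = M} (named k h m) =
  named k h (∈-++⁺ʳ (map _ (stNamed k M)) (∈-map⁺ _ (∈-++⁺ˡ (∈-map⁺ _ m))))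
Licensed-caseL⁺ (boxed o m refl) = boxed (in-caseL o) m refl

Licensed-caseR⁺ : ∀ {K s M N₁ N₂ p} → Licensed s K N₂ p →
                  Licensed s K (app M (case N₁ N₂)) (appA ∷ caseR ∷ p)
Licensed-caseR⁺ {N₁ = N₁} (st m) = st (∈-++⁺ʳ (map _ (stPos N₁)) (∈-map⁺ _ m))
Licensed-caseR⁺ {M = M} {N₁} (named k h m) =
  named k h (∈-++⁺ʳ (map _ (stNamed k M)) (∈-map⁺ _ (∈-++⁺ʳ (map _ (stNamed k N₁)) (∈-map⁺ _ m))))
Licensed-caseR⁺ (boxed o m refl) = boxed (in-caseR o) m refl

Licensed-pairL⁺ : ∀ {K M N p} → Licensed false K M p → Licensed false K (pair M N) (pairL ∷ p)
Licensed-pairL⁺ (named k h m)    = named k h (∈-++⁺ˡ (∈-map⁺ _ m))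
Licensed-pairL⁺ (boxed o m refl) = boxed (in-pairL o) m refl

Licensed-pairR⁺ : ∀ {K M N p} → Licensed false K N p → Licensed false K (pair M N) (pairR ∷ p)
Licensed-pairR⁺ {M = M} (named k h m) = named k h (∈-++⁺ʳ (map _ (stNamed k M)) (∈-map⁺ _ m))
Licensed-pairR⁺ (boxed o m refl)      = boxed (in-pairR o) m refl

Licensed-ω₁⁺ : ∀ {K M p} → Licensed false K M p → Licensed false K (ω₁ M) (ω₁D ∷ p)
Licensed-ω₁⁺ (named k h m)    = named k h (∈-map⁺ _ m)
Licensed-ω₁⁺ (boxed o m refl) = boxed (in-ω₁ o) m refl

Licensed-ω₂⁺ : ∀ {K M p} → Licensed false K M p → Licensed false K (ω₂ M) (ω₂D ∷ p)
Licensed-ω₂⁺ (named k h m)    = named k h (∈-map⁺ _ m)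
Licensed-ω₂⁺ (boxed o m refl) = boxed (in-ω₂ o) m refl

Licensed-μ⁺ : ∀ {K s M p} → Licensed false (s ∷ᵐ K) M p → Licensed s K (μ M) (μD ∷ p)
Licensed-μ⁺ (named zero    refl m) = st (∈-map⁺ _ m)
Licensed-μ⁺ (named (suc k) h    m) = named k h (∈-map⁺ _ m)
Licensed-μ⁺ (boxed o m refl)       = boxed (in-μ o) m refl

Licensed-nam⁺ : ∀ {K s a M p} → K a ≡ s → Licensed s K M p → Licensed false K (nam a M) (namD ∷ p)
Licensed-nam⁺ {a = a} {M} h (st m) = named a h (stPos⊆stNamed-nam a {M} m)
Licensed-nam⁺ {a = a} {M} _ (named k h m) =
  named k h (∈-++⁺ʳ (if a ≡ᵇ k then map _ (stPos M) else []) (∈-map⁺ _ m))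
Licensed-nam⁺ _ (boxed o m refl) = boxed (in-nam o) m refl

Wf⇒Licensed : ∀ {K s M p N} → Wf K s M → Occ M p (star N) → Licensed s K M p
Wf⇒Licensed star                 here         = st (here refl)
Wf⇒Licensed (lam d)              (in-lam o)   = Licensed-lam⁺ (Wf⇒Licensed d o)
Wf⇒Licensed (app d el)           (in-appF o)  = Licensed-appF⁺ el (Wf⇒Licensed d o)
Wf⇒Licensed (app _ (arg d))      (in-arg o)   = Licensed-arg⁺ (Wf⇒Licensed d o)
Wf⇒Licensed (app _ (case d _))   (in-caseL o) = Licensed-caseL⁺ (Wf⇒Licensed d o)
Wf⇒Licensed (app _ (case _ d))   (in-caseR o) = Licensed-caseR⁺ (Wf⇒Licensed d o)
Wf⇒Licensed (pair d _)           (in-pairL o) = Licensed-pairL⁺ (Wf⇒Licensed d o)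
Wf⇒Licensed (pair _ d)           (in-pairR o) = Licensed-pairR⁺ (Wf⇒Licensed d o)
Wf⇒Licensed (ω₁ d)               (in-ω₁ o)    = Licensed-ω₁⁺ (Wf⇒Licensed d o)
Wf⇒Licensed (ω₂ d)               (in-ω₂ o)    = Licensed-ω₂⁺ (Wf⇒Licensed d o)
Wf⇒Licensed (μ d)                (in-μ o)     = Licensed-μ⁺ (Wf⇒Licensed d o)
Wf⇒Licensed (nam h d)            (in-nam o)   = Licensed-nam⁺ h (Wf⇒Licensed d o)

isBox : El' → Bool
isBox (box _) = true
isBox _       = false

Licensed-lam⁻ : ∀ {K M p} → Licensed false K (lam M) (lamD ∷ p) → Licensed false K M p
Licensed-lam⁻ (named k h m)             = named k h (∈-map-∷⁻ m)
Licensed-lam⁻ (boxed (in-lam o) m refl) = boxed o m refl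

Licensed-appF⁻ : ∀ {K s M e p} → Licensed s K (app M e) (appF ∷ p) → Licensed (isBox e) K M p
Licensed-appF⁻ {e = case N₁ _} (st m) with ∈-++⁻ (map _ (stPos N₁)) m
... | inj₁ m' with ∈-map⁻ _ m'
...   | _ , _ , ()
Licensed-appF⁻ {e = case N₁ _} (st m) | inj₂ m' with ∈-map⁻ _ m'
...   | _ , _ , ()
Licensed-appF⁻ {M = M} (named k h m)   = named k h (∈-++-map-∷ˡ⁻ (stNamed k M) (λ ()) m)
Licensed-appF⁻ (boxed here m refl)       = st m
Licensed-appF⁻ (boxed (in-appF o) m refl) = boxed o m refl

Licensed-arg⁻ : ∀ {K M Q p} → Licensed false K (app M (arg Q)) (appA ∷ argD ∷ p) → Licensed false K Q p
Licensed-arg⁻ {M = M} (named k h m)    = named k h (∈-map-∷⁻ (∈-++-map-∷ʳ⁻ (stNamed k M) (λ ()) m))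
Licensed-arg⁻ (boxed (in-arg o) m refl) = boxed o m refl

Licensed-caseL⁻ : ∀ {K s M N₁ N₂ p} → Licensed s K (app M (case N₁ N₂)) (appA ∷ caseL ∷ p) →
                  Licensed s K N₁ p
Licensed-caseL⁻ {N₁ = N₁} (st m) with ∈-++⁻ (map _ (stPos N₁)) m
... | inj₁ m' with ∈-map⁻ _ m'
...   | _ , m'' , refl = st m''
Licensed-caseL⁻ {N₁ = N₁} (st m) | inj₂ m' with ∈-map⁻ _ m'
...   | _ , _ , ()
Licensed-caseL⁻ {M = M} {N₁} (named k h m) =
  named k h (∈-++-map-∷ˡ⁻ (stNamed k N₁) (λ ()) (∈-++-map-∷ʳ⁻ (stNamed k M) (λ ()) m))
Licensed-caseL⁻ (boxed (in-caseL o) m refl) = boxed o m refl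

Licensed-caseR⁻ : ∀ {K s M N₁ N₂ p} → Licensed s K (app M (case N₁ N₂)) (appA ∷ caseR ∷ p) →
                  Licensed s K N₂ p
Licensed-caseR⁻ {N₁ = N₁} (st m) with ∈-++⁻ (map _ (stPos N₁)) m
... | inj₂ m' with ∈-map⁻ _ m'
...   | _ , m'' , refl = st m''
Licensed-caseR⁻ {N₁ = N₁} (st m) | inj₁ m' with ∈-map⁻ _ m'
...   | _ , _ , ()
Licensed-caseR⁻ {M = M} {N₁} (named k h m) =
  named k h (∈-++-map-∷ʳ⁻ (stNamed k N₁) (λ ()) (∈-++-map-∷ʳ⁻ (stNamed k M) (λ ()) m))
Licensed-caseR⁻ (boxed (in-caseR o) m refl) = boxed o m refl

Licensed-pairL⁻ : ∀ {K M N p} → Licensed false K (pair M N) (pairL ∷ p) → Licensed false K M p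
Licensed-pairL⁻ {M = M} (named k h m)    = named k h (∈-++-map-∷ˡ⁻ (stNamed k M) (λ ()) m)
Licensed-pairL⁻ (boxed (in-pairL o) m refl) = boxed o m refl

Licensed-pairR⁻ : ∀ {K M N p} → Licensed false K (pair M N) (pairR ∷ p) → Licensed false K N p
Licensed-pairR⁻ {M = M} (named k h m)    = named k h (∈-++-map-∷ʳ⁻ (stNamed k M) (λ ()) m)
Licensed-pairR⁻ (boxed (in-pairR o) m refl) = boxed o m refl

Licensed-ω₁⁻ : ∀ {K M p} → Licensed false K (ω₁ M) (ω₁D ∷ p) → Licensed false K M p
Licensed-ω₁⁻ (named k h m)            = named k h (∈-map-∷⁻ m)
Licensed-ω₁⁻ (boxed (in-ω₁ o) m refl) = boxed o m refl

Licensed-ω₂⁻ : ∀ {K M p} → Licensed false K (ω₂ M) (ω₂D ∷ p) → Licensed false K M p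
Licensed-ω₂⁻ (named k h m)            = named k h (∈-map-∷⁻ m)
Licensed-ω₂⁻ (boxed (in-ω₂ o) m refl) = boxed o m refl

Licensed-μ⁻ : ∀ {K s M p} → Licensed s K (μ M) (μD ∷ p) → Licensed false (s ∷ᵐ K) M p
Licensed-μ⁻ (st m)                  = named zero refl (∈-map-∷⁻ m)
Licensed-μ⁻ (named k h m)           = named (suc k) h (∈-map-∷⁻ m)
Licensed-μ⁻ (boxed (in-μ o) m refl) = boxed o m refl

Licensed-nam⁻ : ∀ {K a M p} → Licensed false K (nam a M) (namD ∷ p) → Licensed (K a) K M p
Licensed-nam⁻ {K} {a} {M} {p} (named k h m) with a ≡ᵇ k | ≡ᵇ-reflects-≡ a k
... | false | _ = named k h (∈-map-∷⁻ m)
... | true  | ofʸ refl with ∈-++⁻ (map _ (stPos M)) m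
...   | inj₁ m' = subst (λ s → Licensed s K M p) (sym h) (st (∈-map-∷⁻ m'))
...   | inj₂ m' = named k h (∈-map-∷⁻ m')
Licensed-nam⁻ (boxed (in-nam o) m refl) = boxed o m refl

record Invariant (s : Bool) (K : Modes) (M : Tm') : Set where
  field
    box-heads  : ∀ {q U b} → Occ M q (app U (box b)) → Acceptable U
    stars      : ∀ {p N} → Occ M p (star N) → Licensed s K M p
    acceptable : s ≡ true → Acceptable M
    named-args : ∀ k → K k ≡ true → All Acceptable (namedArgs k M)
open Invariant

Invariant-sub : ∀ {s K M s' K' M'} ds → (∀ {p X} → Occ M p X → Occ M' (ds ++ p) X) →
                (∀ {p} → Licensed s' K' M' (ds ++ p) → Licensed s K M p) →
                (s ≡ true → Acceptable M) → (∀ k → K k ≡ true → All Acceptable (namedArgs k M)) →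
                Invariant s' K' M' → Invariant s K M
Invariant-sub ds wrap unwrap acc args inv = record
  { box-heads  = λ o → box-heads inv (wrap o)
  ; stars      = λ o → unwrap (stars inv (wrap o))
  ; acceptable = acc
  ; named-args = args
  }

Invariant-lam : ∀ {K M} → Invariant false K (lam M) → Invariant false K M
Invariant-lam inv = Invariant-sub (lamD ∷ []) in-lam Licensed-lam⁻ (λ ()) (named-args inv) inv

head-acceptable : ∀ {s K M e} → Invariant s K (app M e) → isBox e ≡ true → Acceptable M
head-acceptable {e = box _} inv _ = box-heads inv here

Invariant-appF : ∀ {s K M e} → Invariant s K (app M e) → Invariant (isBox e) K M
Invariant-appF {M = M} inv = Invariant-sub (appF ∷ []) in-appF Licensed-appF⁻ (head-acceptable inv)
  (λ k h → All.++⁻ˡ (namedArgs k M) (named-args inv k h)) inv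

Invariant-arg : ∀ {K M Q} → Invariant false K (app M (arg Q)) → Invariant false K Q
Invariant-arg {M = M} inv = Invariant-sub (appA ∷ argD ∷ []) in-arg Licensed-arg⁻ (λ ())
  (λ k h → All.++⁻ʳ (namedArgs k M) (named-args inv k h)) inv

Invariant-caseL : ∀ {s K M N₁ N₂} → Invariant s K (app M (case N₁ N₂)) → Invariant s K N₁
Invariant-caseL {M = M} {N₁} inv = Invariant-sub (appA ∷ caseL ∷ []) in-caseL Licensed-caseL⁻
  (λ h → case acceptable inv h of λ { (acc[] a₁ _) → a₁ })
  (λ k h → All.++⁻ˡ (namedArgs k N₁) (All.++⁻ʳ (namedArgs k M) (named-args inv k h))) inv

Invariant-caseR : ∀ {s K M N₁ N₂} → Invariant s K (app M (case N₁ N₂)) → Invariant s K N₂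
Invariant-caseR {M = M} {N₁} inv = Invariant-sub (appA ∷ caseR ∷ []) in-caseR Licensed-caseR⁻
  (λ h → case acceptable inv h of λ { (acc[] _ a₂) → a₂ })
  (λ k h → All.++⁻ʳ (namedArgs k N₁) (All.++⁻ʳ (namedArgs k M) (named-args inv k h))) inv

Invariant-pairL : ∀ {K M N} → Invariant false K (pair M N) → Invariant false K M
Invariant-pairL {M = M} inv = Invariant-sub (pairL ∷ []) in-pairL Licensed-pairL⁻ (λ ())
  (λ k h → All.++⁻ˡ (namedArgs k M) (named-args inv k h)) inv

Invariant-pairR : ∀ {K M N} → Invariant false K (pair M N) → Invariant false K N
Invariant-pairR {M = M} inv = Invariant-sub (pairR ∷ []) in-pairR Licensed-pairR⁻ (λ ())
  (λ k h → All.++⁻ʳ (namedArgs k M) (named-args inv k h)) inv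

Invariant-ω₁ : ∀ {K M} → Invariant false K (ω₁ M) → Invariant false K M
Invariant-ω₁ inv = Invariant-sub (ω₁D ∷ []) in-ω₁ Licensed-ω₁⁻ (λ ()) (named-args inv) inv

Invariant-ω₂ : ∀ {K M} → Invariant false K (ω₂ M) → Invariant false K M
Invariant-ω₂ inv = Invariant-sub (ω₂D ∷ []) in-ω₂ Licensed-ω₂⁻ (λ ()) (named-args inv) inv

Invariant-μ : ∀ {s K M} → Invariant s K (μ M) → Invariant false (s ∷ᵐ K) M
Invariant-μ {s} {K} {M} inv = Invariant-sub (μD ∷ []) in-μ Licensed-μ⁻ (λ ()) named-μ inv
  where
  named-μ : ∀ k → (s ∷ᵐ K) k ≡ true → All Acceptable (namedArgs k M)
  named-μ zero    h with acceptable inv h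
  ... | accμ al = al
  named-μ (suc k) h = named-args inv k h

Invariant-nam : ∀ {K a M} → Invariant false K (nam a M) → Invariant (K a) K M
Invariant-nam {K} {a} {M} inv = Invariant-sub (namD ∷ []) in-nam Licensed-nam⁻ acc-nam
  (λ k h → All.++⁻ʳ (if a ≡ᵇ k then M ∷ [] else []) (named-args inv k h)) inv
  where
  acc-nam : K a ≡ true → Acceptable M
  acc-nam h with a ≡ᵇ a | ≡ᵇ-reflects-≡ a a | named-args inv a h
  ... | true  | _       | acc ∷ _ = acc
  ... | false | ofⁿ a≢a | _       = contradiction refl a≢a

Invariant⇒Wf : ∀ {s K} M → Invariant s K M → Wf K s M
Invariant⇒Wf {true} M inv with acceptable inv refl
... | acc⋆       = star
... | accμ _     = μ (Invariant⇒Wf _ (Invariant-μ inv))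
... | acc[] _ _  = app (Invariant⇒Wf _ (Invariant-appF inv))
                       (case (Invariant⇒Wf _ (Invariant-caseL inv)) (Invariant⇒Wf _ (Invariant-caseR inv)))
Invariant⇒Wf {false} (var j)    inv = var
Invariant⇒Wf {false} (lam M)    inv = lam (Invariant⇒Wf M (Invariant-lam inv))
Invariant⇒Wf {false} (app M (arg Q)) inv =
  app (Invariant⇒Wf M (Invariant-appF inv)) (arg (Invariant⇒Wf Q (Invariant-arg inv)))
Invariant⇒Wf {false} (app M π₁) inv = app (Invariant⇒Wf M (Invariant-appF inv)) π₁
Invariant⇒Wf {false} (app M π₂) inv = app (Invariant⇒Wf M (Invariant-appF inv)) π₂
Invariant⇒Wf {false} (app M (case N₁ N₂)) inv =
  app (Invariant⇒Wf M (Invariant-appF inv))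
      (case (Invariant⇒Wf N₁ (Invariant-caseL inv)) (Invariant⇒Wf N₂ (Invariant-caseR inv)))
Invariant⇒Wf {false} (app M (box b)) inv = app (Invariant⇒Wf M (Invariant-appF inv)) box
Invariant⇒Wf {false} (pair M N) inv =
  pair (Invariant⇒Wf M (Invariant-pairL inv)) (Invariant⇒Wf N (Invariant-pairR inv))
Invariant⇒Wf {false} (ω₁ M)     inv = ω₁ (Invariant⇒Wf M (Invariant-ω₁ inv))
Invariant⇒Wf {false} (ω₂ M)     inv = ω₂ (Invariant⇒Wf M (Invariant-ω₂ inv))
Invariant⇒Wf {false} (μ M)      inv = μ (Invariant⇒Wf M (Invariant-μ inv))
Invariant⇒Wf {false} (nam a M)  inv = nam refl (Invariant⇒Wf M (Invariant-nam inv))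
Invariant⇒Wf {false} (star N)   inv with stars inv here
... | named k h ()

plainModes : Modes
plainModes _ = false

Correct⇒Wf : ∀ {M} → Correct M → Wf plainModes false M
Correct⇒Wf {M} cor = Invariant⇒Wf M (record
  { box-heads  = λ {q} {U} {b} o → Correct.boxes cor q U b (Occ⇒atT o)
  ; stars      = stars-licensed
  ; acceptable = λ ()
  ; named-args = λ _ ()
  })
  where
  stars-licensed : ∀ {p N} → Occ M p (star N) → Licensed false plainModes M p
  stars-licensed {p} {N} o with Correct.stars cor p N (Occ⇒atT o)
  ... | q , _ , _ , _ , at , m , eq = boxed (atT⇒Occ M q at) m eq

Wf⇒Correct : ∀ {M} → Wf plainModes false M → Correct M
Wf⇒Correct {M} d = record
  { boxes = λ p U b at → Wf⇒boxed-Acceptable d (atT⇒Occ M p at)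
  ; stars = λ p N at → covering (Wf⇒Licensed d (atT⇒Occ M p at))
  }
  where
  covering : ∀ {p} → Licensed false plainModes M p →
             Σ Pos λ q → Σ Tm' λ U → Σ Box λ b → Σ Pos λ r →
               atT M q ≡ just (app U (box b)) × r ∈ stPos U × p ≡ q ++ appF ∷ r
  covering (boxed o m eq) = _ , _ , _ , _ , Occ⇒atT o , m , eq

lemma5p8 : (M : Tm') (N : Tm) → Correct M → T₁ M ⟶ N →
           Σ Tm' λ M' → Correct M' × TransClosure _⟶'_ M M' × T₁ M' ≡ N
lemma5p8 M N correct step with simulate (Correct⇒Wf correct) step
... | M' , steps , T₁M'≡N =
  M' , Wf⇒Correct (Wf-Red'⁺ (λ _ → refl) steps (Correct⇒Wf correct)) , steps , T₁M'≡N
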